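{- Let $m,n$ be even nonnegative integers. If $A(m)$ and $A(n)$ are isomorphic as edge-labeled directed graphs, then $m=n$.
   Context: Let $\Sigma^*$ be the free monoid of finite words over the alphabet $\{0,1,2\}$ (including the empty word). A word $x_0x_1\cdots x_k\in\Sigma^*$ with $x_0\neq 0$ is a hyperbinary expansion of the nonnegative integer $\sum_{i=0}^k x_i2^{k-i}$; the empty word is the unique hyperbinary expansion of $0$. Let $\mathcal{H}(n)$ be the set of hyperbinary expansions of $n$. The edge-labeled directed graph $A(n)$ has vertex set $\mathcal{H}(n)$; its arcs are all pairs $(u,w)$ of elements of $\mathcal{H}(n)$ of one of the forms: $(\mathbf{x}02\mathbf{y},\mathbf{x}10\mathbf{y})$ or $(2\mathbf{y},10\mathbf{y})$ with $\mathbf{x},\mathbf{y}\in\Sigma^*$, labeled $\to$; or $(\mathbf{x}12\mathbf{y},\mathbf{x}20\mathbf{y})$ with $\mathbf{x},\mathbf{y}\in\Sigma^*$, labeled $\twoheadrightarrow$. An isomorphism of edge-labeled directed graphs is a bijection of vertex sets inducing a bijection of arcs that preserves the labels. -}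

module Defs where

open import Data.Nat using (ℕ; zero; suc; _+_; _*_)
open import Data.List using (List; []; _∷_; _++_; foldl)
open import Data.Product using (Σ; _×_; proj₁)
open import Data.Unit using (⊤)
open import Data.Empty using (⊥)
open import Relation.Binary.PropositionalEquality using (_≡_)
open import Function.Bundles using (_↔_; Inverse; _⇔_)

data Digit : Set where
  d0 d1 d2 : Digit

digitVal : Digit → ℕ
digitVal d0 = 0
digitVal d1 = 1
digitVal d2 = 2

Word : Set
Word = List Digit

value : Word → ℕ
value = foldl (λ acc d → 2 * acc + digitVal d) 0

LeadingNonzero : Word → Set
LeadingNonzero []         = ⊤
LeadingNonzero (d0 ∷ _)   = ⊥
LeadingNonzero (d1 ∷ _)   = ⊤
LeadingNonzero (d2 ∷ _)   = ⊤

IsHyperbinary : ℕ → Word → Set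
IsHyperbinary n w = LeadingNonzero w × value w ≡ n

H : ℕ → Set
H n = Σ Word (IsHyperbinary n)

data Arrow : Word → Word → Set where
  inner : (x y : Word) → Arrow (x ++ (d0 ∷ d2 ∷ y)) (x ++ (d1 ∷ d0 ∷ y))
  front : (y : Word) → Arrow (d2 ∷ y) (d1 ∷ d0 ∷ y)

data DArrow : Word → Word → Set where
  inner : (x y : Word) → DArrow (x ++ (d1 ∷ d2 ∷ y)) (x ++ (d2 ∷ d0 ∷ y))

record AIso (m n : ℕ) : Set where
  field
    bij      : H m ↔ H n
  open Inverse bij public using (to)
  field
    pres→    : (u w : H m) → Arrow  (proj₁ u) (proj₁ w) ⇔ Arrow  (proj₁ (to u)) (proj₁ (to w))
    pres↠    : (u w : H m) → DArrow (proj₁ u) (proj₁ w) ⇔ DArrow (proj₁ (to u)) (proj₁ (to w))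

Isomorphic : ℕ → ℕ → Set
Isomorphic m n = AIso m n

{-# OPTIONS --safe #-}

-- Write n = 2F and let B be the binary digits of F, least significant first.  A
-- hyperbinary expansion of n is determined by its carries against the binary expansion
-- false ∷ B of n, one per position of B, and the possible carry vectors are exactly
-- the monotone maps to Bool on the fence of B: the partial order on positions generated
-- by i ≺ i + 1 when bit i is 0 and i + 1 ≺ i when it is 1.  An arc 02 ↦ 10 or 12 ↦ 20
-- lowers exactly one carry, at a position whose bit is 1 or 0 respectively, and every
-- lowering that stays monotone is an arc.  So A(n) is the labelled Hasse diagram of the
-- up-sets of the labelled fence of B.  The vertices with a unique predecessor are the
-- complements of the principal down-sets, and reachability between them is the fence
-- order; hence an isomorphism A(m) ≅ A(n) induces a label-preserving isomorphism of
-- fences.  It preserves covering pairs, so it is an isomorphism of paths: the identity,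
-- which forces equal bit strings, or the reversal, which turns every edge of the fence
-- around and thereby forces consecutive bits to differ, so that both strings are
-- 1, 0, 1, …, 1 and coincide again.

module Submission where

open import Defs
open import Data.Bool.Base as 𝔹 using (Bool; true; false; not; T; f≤t; b≤b; if_then_else_)
open import Data.Bool.Properties using (not-injective; ¬-not)
  renaming (_≟_ to _≟ᵇ_; ≤-minimum to false≤; ≤-maximum to ≤true; ≤-reflexive to ≤ᵇ-reflexive; ≤-trans to ≤ᵇ-trans)
open import Data.Nat.Base using (ℕ; zero; suc; _+_; _∸_; _*_; _≤_; _<_; z≤n; s≤s; _≤′_; ≤′-refl; ≤′-step)
open import Data.Nat.Properties
open import Data.Nat.Divisibility using (_∣_; divides)
open import Data.List.Base using (List; []; _∷_; _++_; _∷ʳ_; length; reverse)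
open import Data.List.Properties using (unfold-reverse; foldl-∷ʳ; reverse-involutive; reverse-++; ++-assoc)
open import Data.Product.Base using (∃-syntax; _×_; _,_; proj₁; proj₂; map₂)
open import Data.Sum.Base using (_⊎_; inj₁; inj₂; [_,_]′) renaming (map to ⊎-map)
open import Data.Empty using (⊥; ⊥-elim)
open import Data.Unit.Base using (⊤; tt)
open import Relation.Nullary using (¬_; Dec; yes; no; does; contradiction)
open import Relation.Nullary.Decidable using (_×-dec_; _⊎-dec_; ¬?; ⌊_⌋; dec-true; dec-false)
open import Relation.Unary using (Pred; Decidable)
open import Relation.Binary.Core using (Rel)
open import Relation.Binary.Definitions using (Reflexive; Transitive; tri<; tri≈; tri>)
open import Level using (0ℓ)
open import Function.Base using (_∘_)
open import Function.Bundles using (Inverse; Equivalence; _⇔_; mk⇔)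
open import Function.Properties.Inverse using (↔-sym)
open import Relation.Binary.PropositionalEquality
open import Relation.Binary.Construct.Closure.ReflexiveTransitive using (Star; ε; _◅_; gmap)

-- Binary representations

double : ℕ → ℕ
double zero    = zero
double (suc n) = suc (suc (double n))

double-injective : ∀ {m n} → double m ≡ double n → m ≡ n
double-injective {zero}  {zero}  _  = refl
double-injective {suc m} {suc n} eq = cong suc (double-injective (suc-injective (suc-injective eq)))

double≢suc-double : ∀ m n → double m ≢ suc (double n)
double≢suc-double (suc m) (suc n) eq = double≢suc-double m n (suc-injective (suc-injective eq))

double≡2* : ∀ n → double n ≡ 2 * n
double≡2* zero    = refl
double≡2* (suc n) = cong suc (trans (cong suc (double≡2* n)) (sym (+-suc n (n + 0))))

bitVal : Bool → ℕ
bitVal false = 0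
bitVal true  = 1

double-+ : ∀ m n → double (m + n) ≡ double m + double n
double-+ zero    n = refl
double-+ (suc m) n = cong (suc ∘ suc) (double-+ m n)

bitAt : List Bool → ℕ → Bool
bitAt []       _       = false
bitAt (b ∷ _)  zero    = b
bitAt (_ ∷ bs) (suc i) = bitAt bs i

Last : ∀ {A : Set} → (A → Set) → List A → Set
Last P []           = ⊤
Last P (x ∷ [])     = P x
Last P (_ ∷ y ∷ ys) = Last P (y ∷ ys)

last-tail : ∀ {A : Set} {P : A → Set} x xs → Last P (x ∷ xs) → Last P xs
last-tail _ []      _ = tt
last-tail _ (_ ∷ _) p = p

last-cons : ∀ {A : Set} {P : A → Set} x xs → Last P xs → (xs ≡ [] → P x) → Last P (x ∷ xs)
last-cons _ []      _ px = px refl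
last-cons _ (_ ∷ _) p  _ = p

Canonical : List Bool → Set
Canonical = Last T

bitsValue : List Bool → ℕ
bitsValue []       = 0
bitsValue (b ∷ bs) = bitVal b + double (bitsValue bs)

canonical-nonzero : ∀ b bs → Canonical (b ∷ bs) → bitsValue (b ∷ bs) ≢ 0
canonical-nonzero true  []       _ ()
canonical-nonzero false (b ∷ bs) c eq = canonical-nonzero b bs c (double-injective eq)
canonical-nonzero true  (_ ∷ _)  _ ()

canonical-last : ∀ bs {t} → Canonical bs → suc t ≡ length bs → bitAt bs t ≡ true
canonical-last (true ∷ [])  {zero}  _ _  = refl
canonical-last (_ ∷ b ∷ bs) {suc t} c eq = canonical-last (b ∷ bs) c (suc-injective eq)

bitAt-beyond : ∀ bs {t} → length bs ≤ t → bitAt bs t ≡ false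
bitAt-beyond []       _         = refl
bitAt-beyond (_ ∷ bs) (s≤s len≤t) = bitAt-beyond bs len≤t

increment : List Bool → List Bool
increment []           = true ∷ []
increment (false ∷ bs) = true ∷ bs
increment (true  ∷ bs) = false ∷ increment bs

increment-value : ∀ bs → bitsValue (increment bs) ≡ suc (bitsValue bs)
increment-value []           = refl
increment-value (false ∷ bs) = refl
increment-value (true  ∷ bs) = cong double (increment-value bs)

increment-canonical : ∀ bs → Canonical bs → Canonical (increment bs)
increment-canonical []               _ = tt
increment-canonical (false ∷ b ∷ bs) c = c
increment-canonical (true  ∷ bs)     c =
  last-cons false (increment bs) (increment-canonical bs (last-tail true bs c)) (nonempty bs)
  where
  nonempty : ∀ bs → increment bs ≡ [] → T false
  nonempty []          ()
  nonempty (false ∷ _) ()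
  nonempty (true  ∷ _) ()

binary : ℕ → List Bool
binary zero    = []
binary (suc n) = increment (binary n)

binary-canonical : ∀ n → Canonical (binary n)
binary-canonical zero    = tt
binary-canonical (suc n) = increment-canonical (binary n) (binary-canonical n)

binary-value : ∀ n → bitsValue (binary n) ≡ n
binary-value zero    = refl
binary-value (suc n) = trans (increment-value (binary n)) (cong suc (binary-value n))

-- The fence of a bit string

Adjacent : ℕ → ℕ → Set
Adjacent i j = suc i ≡ j ⊎ suc j ≡ i

adjacent-sym : ∀ {i k} → Adjacent i k → Adjacent k i
adjacent-sym (inj₁ eq) = inj₂ eq
adjacent-sym (inj₂ eq) = inj₁ eq

nothing-between : ∀ {a b c} → a < b → b < c → ¬ Adjacent a c
nothing-between a<b b<c (inj₁ refl) = <⇒≱ a<b (≤-pred b<c)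
nothing-between a<b b<c (inj₂ refl) = <⇒≱ (<-trans a<b b<c) (n≤1+n _)

Admissible : Bool → Bool → Bool → Set
Admissible false x y = x 𝔹.≤ y
Admissible true  x y = y 𝔹.≤ x

≤ᵇ-true : ∀ {x y} → x 𝔹.≤ y → x ≡ true → y ≡ true
≤ᵇ-true b≤b refl = refl

≤ᵇ-false : ∀ {x y} → x 𝔹.≤ y → y ≡ false → x ≡ false
≤ᵇ-false b≤b refl = refl

≤ᵇ-from-true : ∀ {x y} → (x ≡ true → y ≡ true) → x 𝔹.≤ y
≤ᵇ-from-true {false} _ = false≤ _
≤ᵇ-from-true {true}  h = ≤ᵇ-reflexive (sym (h refl))

update : ℕ → Bool → (ℕ → Bool) → ℕ → Bool
update k x d i = if ⌊ i ≟ k ⌋ then x else d i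

update-same : ∀ k x d → update k x d k ≡ x
update-same k x d rewrite ≟-diag (refl {x = k}) = refl

update-other : ∀ {k i} x d → i ≢ k → update k x d i ≡ d i
update-other {k} {i} x d i≢k with i ≟ k
... | yes i≡k = contradiction i≡k i≢k
... | no  _   = refl

update-true : ∀ {k d m} → update k true d m ≡ true → m ≡ k ⊎ d m ≡ true
update-true {k} {d} {m} eq with m ≟ k
... | yes m≡k = inj₁ m≡k
... | no  _   = inj₂ eq

stepwise : ∀ {A : Set} (_∼_ : Rel A 0ℓ) → Reflexive _∼_ → Transitive _∼_ →
           (f : ℕ → A) {i k : ℕ} → (∀ {t} → i ≤ t → t < k → f t ∼ f (suc t)) → i ≤ k → f i ∼ f k
stepwise _∼_ refl∼ trans∼ f {i} {k} steps i≤k = go (≤⇒≤′ i≤k) ≤-refl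
  where
  go : ∀ {j} → i ≤′ j → j ≤ k → f i ∼ f j
  go ≤′-refl        _   = refl∼
  go (≤′-step i≤′j) j<k = trans∼ (go i≤′j (<⇒≤ j<k)) (steps (≤′⇒≤ i≤′j) j<k)

does-true : ∀ {A : Set} (a? : Dec A) → does a? ≡ true → A
does-true (yes a) _ = a

does-false : ∀ {A : Set} (a? : Dec A) → does a? ≡ false → ¬ A
does-false (no ¬a) _ = ¬a

bounded-search : ∀ {P : Pred ℕ 0ℓ} → Decidable P → ∀ n → (∃[ t ] t < n × P t) ⊎ (∀ {t} → t < n → ¬ P t)
bounded-search P? zero    = inj₂ λ ()
bounded-search P? (suc n) with P? n | bounded-search P? n
... | yes Pn | _                  = inj₁ (n , ≤-refl , Pn)
... | no _   | inj₁ (t , t<n , Pt) = inj₁ (t , <-trans t<n (n<1+n n) , Pt)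
... | no ¬Pn | inj₂ none          = inj₂ λ t<1+n → [ none , (λ { refl → ¬Pn }) ]′ (m≤n⇒m<n∨m≡n (≤-pred t<1+n))

module Fence (bit : ℕ → Bool) where

  Run : Bool → ℕ → ℕ → Set
  Run b i k = ∀ {t} → i ≤ t → t < k → bit t ≡ b

  infix 4 _≼_
  _≼_ : ℕ → ℕ → Set
  i ≼ k = (i ≤ k × Run false i k) ⊎ (k ≤ i × Run true k i)

  run-empty : ∀ {b i k} → k ≤ i → Run b i k
  run-empty k≤i i≤t t<k = contradiction (<-≤-trans t<k k≤i) (≤⇒≯ i≤t)

  run-restrict : ∀ {b i i′ k k′} → i ≤ i′ → k′ ≤ k → Run b i k → Run b i′ k′
  run-restrict i≤i′ k′≤k r i′≤t t<k′ = r (≤-trans i≤i′ i′≤t) (<-≤-trans t<k′ k′≤k)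

  run-++ : ∀ {b i j k} → Run b i j → Run b j k → Run b i k
  run-++ {j = j} r r′ {t} i≤t t<k with t <? j
  ... | yes t<j = r i≤t t<j
  ... | no  t≮j = r′ (≮⇒≥ t≮j) t<k

  run-cons : ∀ {b i k} → bit i ≡ b → Run b (suc i) k → Run b i k
  run-cons bi r i≤t t<k with m≤n⇒m<n∨m≡n i≤t
  ... | inj₁ i<t  = r i<t t<k
  ... | inj₂ refl = bi

  run-snoc : ∀ {b i k} → Run b i k → bit k ≡ b → Run b i (suc k)
  run-snoc r bk i≤t t<1+k with m≤n⇒m<n∨m≡n (≤-pred t<1+k)
  ... | inj₁ t<k  = r i≤t t<k
  ... | inj₂ refl = bk

  run? : ∀ b i k → Dec (Run b i k)
  run? b i zero = yes (run-empty z≤n)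
  run? b i (suc k) with i ≤? k
  ... | no  i≰k = yes (run-empty (≰⇒> i≰k))
  ... | yes i≤k with run? b i k | bit k ≟ᵇ b
  ...   | yes r | yes bk   = yes (run-snoc r bk)
  ...   | no ¬r | _        = no (λ r → ¬r (run-restrict ≤-refl (n≤1+n k) r))
  ...   | yes _ | no bk≢b  = no (λ r → bk≢b (r i≤k ≤-refl))

  infix 4 _≼?_
  _≼?_ : ∀ i k → Dec (i ≼ k)
  i ≼? k = (i ≤? k ×-dec run? false i k) ⊎-dec (k ≤? i ×-dec run? true k i)

  ≼-refl : ∀ {i} → i ≼ i
  ≼-refl = inj₁ (≤-refl , run-empty ≤-refl)

  runs-conflict : ∀ {i k} → Run false i k → Run true i k → i < k → ⊥
  runs-conflict F T i<k with trans (sym (F ≤-refl i<k)) (T ≤-refl i<k)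
  ... | ()

  ≼-antisym : ∀ {i k} → i ≼ k → k ≼ i → i ≡ k
  ≼-antisym (inj₁ (i≤k , _)) (inj₁ (k≤i , _)) = ≤-antisym i≤k k≤i
  ≼-antisym (inj₂ (k≤i , _)) (inj₂ (i≤k , _)) = ≤-antisym i≤k k≤i
  ≼-antisym (inj₁ (i≤k , F)) (inj₂ (_ , T))   = equal-or-conflict i≤k F T
    where
    equal-or-conflict : ∀ {i k} → i ≤ k → Run false i k → Run true i k → i ≡ k
    equal-or-conflict i≤k F T with m≤n⇒m<n∨m≡n i≤k
    ... | inj₁ i<k = ⊥-elim (runs-conflict F T i<k)
    ... | inj₂ i≡k = i≡k
  ≼-antisym (inj₂ (k≤i , T)) (inj₁ (_ , F))   = sym (≼-antisym (inj₁ (k≤i , F)) (inj₂ (k≤i , T)))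

  ≼-trans : ∀ {i j k} → i ≼ j → j ≼ k → i ≼ k
  ≼-trans (inj₁ (i≤j , F₁)) (inj₁ (j≤k , F₂)) = inj₁ (≤-trans i≤j j≤k , run-++ F₁ F₂)
  ≼-trans (inj₂ (j≤i , T₁)) (inj₂ (k≤j , T₂)) = inj₂ (≤-trans k≤j j≤i , run-++ T₂ T₁)
  ≼-trans {i} {_} {k} (inj₁ (i≤j , F)) (inj₂ (k≤j , T)) with ≤-total i k
  ... | inj₁ i≤k = inj₁ (i≤k , run-restrict ≤-refl k≤j F)
  ... | inj₂ k≤i = inj₂ (k≤i , run-restrict ≤-refl i≤j T)
  ≼-trans {i} {_} {k} (inj₂ (j≤i , T)) (inj₁ (j≤k , F)) with ≤-total i k
  ... | inj₁ i≤k = inj₁ (i≤k , run-restrict j≤i ≤-refl F)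
  ... | inj₂ k≤i = inj₂ (k≤i , run-restrict j≤k ≤-refl T)

  ≼-suc : ∀ {i} → bit i ≡ false → i ≼ suc i
  ≼-suc bi = inj₁ (n≤1+n _ , run-snoc (run-empty ≤-refl) bi)

  suc-≼ : ∀ {i} → bit i ≡ true → suc i ≼ i
  suc-≼ bi = inj₂ (n≤1+n _ , run-snoc (run-empty ≤-refl) bi)

  ≼-suc⁻¹ : ∀ {i} → i ≼ suc i → bit i ≡ false
  ≼-suc⁻¹ (inj₁ (_ , F))     = F ≤-refl ≤-refl
  ≼-suc⁻¹ (inj₂ (1+i≤i , _)) = contradiction 1+i≤i 1+n≰n

  suc-≼⁻¹ : ∀ {i} → suc i ≼ i → bit i ≡ true
  suc-≼⁻¹ (inj₂ (_ , T))     = T ≤-refl ≤-refl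
  suc-≼⁻¹ (inj₁ (1+i≤i , _)) = contradiction 1+i≤i 1+n≰n

  not-below-both : ∀ {i t k} → i ≼ t → t ≼ k → t < i → t < k → ⊥
  not-below-both (inj₁ (i≤t , _)) _ t<i _ = contradiction i≤t (<⇒≱ t<i)
  not-below-both _ (inj₂ (k≤t , _)) _ t<k = contradiction k≤t (<⇒≱ t<k)
  not-below-both (inj₂ (_ , T)) (inj₁ (_ , F)) t<i t<k with trans (sym (T ≤-refl t<i)) (F ≤-refl t<k)
  ... | ()

  not-above-both : ∀ {i t k} → i ≼ t → t ≼ k → i < t → k < t → ⊥
  not-above-both (inj₂ (t≤i , _)) _ i<t _ = contradiction t≤i (<⇒≱ i<t)
  not-above-both _ (inj₁ (t≤k , _)) _ k<t = contradiction t≤k (<⇒≱ k<t)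
  not-above-both {t = suc p} (inj₁ (_ , F)) (inj₂ (_ , T)) i<t k<t
    with trans (sym (F (≤-pred i<t) ≤-refl)) (T (≤-pred k<t) ≤-refl)
  ... | ()

  Monotone : (ℕ → Bool) → Set
  Monotone d = ∀ {i k} → i ≼ k → d i 𝔹.≤ d k

  EdgeMonotone : (ℕ → Bool) → Set
  EdgeMonotone d = ∀ i → Admissible (bit i) (d i) (d (suc i))

  monotone⇒edgeMonotone : ∀ {d} → Monotone d → EdgeMonotone d
  monotone⇒edgeMonotone mono i with bit i in bi
  ... | false = mono (≼-suc bi)
  ... | true  = mono (suc-≼ bi)

  edgeMonotone⇒monotone : ∀ {d} → EdgeMonotone d → Monotone d
  edgeMonotone⇒monotone {d} edge (inj₁ (i≤k , F)) =
    stepwise 𝔹._≤_ b≤b ≤ᵇ-trans d (λ i≤t t<k → subst (λ b → Admissible b _ _) (F i≤t t<k) (edge _)) i≤k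
  edgeMonotone⇒monotone {d} edge (inj₂ (k≤i , T)) =
    stepwise (λ x y → y 𝔹.≤ x) b≤b (λ p q → ≤ᵇ-trans q p) d
             (λ k≤t t<i → subst (λ b → Admissible b _ _) (T k≤t t<i) (edge _)) k≤i

  UpClosed DownClosed : Pred ℕ 0ℓ → Set
  UpClosed   S = ∀ {i k} → i ≼ k → S i → S k
  DownClosed S = ∀ {i k} → i ≼ k → S k → S i

  Minimal Maximal : Pred ℕ 0ℓ → ℕ → Set
  Minimal S m = ∀ {t} → t ≼ m → S t → t ≡ m
  Maximal S m = ∀ {t} → m ≼ t → S t → t ≡ m

  lower-monotone : ∀ {d m} → Monotone d → Minimal (λ t → d t ≡ true) m → Monotone (update m false d)
  lower-monotone {d} {m} mono minimal {i} {k} i≼k with i ≟ m | k ≟ m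
  ... | yes refl | _        = false≤ _
  ... | no i≢m   | yes refl = ≤ᵇ-reflexive (¬-not (λ di≡true → i≢m (minimal i≼k di≡true)))
  ... | no _     | no _     = mono i≼k

  raise-monotone : ∀ {d m} → Monotone d → Maximal (λ t → d t ≡ false) m → Monotone (update m true d)
  raise-monotone {d} {m} mono maximal {i} {k} i≼k with i ≟ m | k ≟ m
  ... | _        | yes refl = ≤true _
  ... | yes refl | no k≢m   = ≤ᵇ-reflexive (sym (¬-not (λ dk≡false → k≢m (maximal i≼k dk≡false))))
  ... | no _     | no _     = mono i≼k

  -- A descending walk along the fence never turns around, so a minimal element below x is
  -- found by walking left, or else right, for as long as the neighbour lies below and in S.
  module _ {S : Pred ℕ 0ℓ} (S? : Decidable S) (up : UpClosed S) {L : ℕ} (bounded : ∀ {t} → S t → t < L) where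

    private
      NoLeftDescent NoRightDescent : ℕ → Set
      NoLeftDescent  m = ∀ {p} → suc p ≡ m → bit p ≡ false → ¬ S p
      NoRightDescent m = bit m ≡ true → ¬ S (suc m)

      Result : (ℕ → ℕ → Set) → ℕ → Set
      Result R x = ∃[ m ] R m x × S m × Minimal S m

      stuck⇒minimal : ∀ m → NoLeftDescent m → NoRightDescent m → Minimal S m
      stuck⇒minimal m noL noR {t} (inj₁ (t≤m , F)) St with m≤n⇒m<n∨m≡n t≤m
      ... | inj₂ t≡m = t≡m
      ... | inj₁ t<m with m | t<m
      ...   | suc p | s≤s t≤p =
        contradiction (up (inj₁ (t≤p , run-restrict ≤-refl (n≤1+n p) F)) St) (noL refl (F t≤p ≤-refl))
      stuck⇒minimal m noL noR {t} (inj₂ (m≤t , T)) St with m≤n⇒m<n∨m≡n m≤t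
      ... | inj₂ m≡t = sym m≡t
      ... | inj₁ m<t = contradiction (up (inj₂ (m<t , run-restrict (n≤1+n m) ≤-refl T)) St) (noR (T ≤-refl m<t))

      descend-left : ∀ m → S m → NoRightDescent m → Result (λ m′ m → m′ ≤ m × Run false m′ m) m
      descend-left zero    Sm noR = zero , (≤-refl , run-empty ≤-refl) , Sm , stuck⇒minimal zero (λ ()) noR
      descend-left (suc p) Sm noR with bit p in bp | S? p
      ... | false | yes Sp =
        let m , (m≤p , F) , Sm′ , minimal = descend-left p Sp (λ bp≡true → contradiction (trans (sym bp) bp≡true) λ ())
        in m , (m≤n⇒m≤1+n m≤p , run-snoc F bp) , Sm′ , minimal
      ... | false | no ¬Sp = suc p , (≤-refl , run-empty ≤-refl) , Sm , stuck⇒minimal (suc p) (λ { refl _ → ¬Sp }) noR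
      ... | true  | _      = suc p , (≤-refl , run-empty ≤-refl) , Sm ,
                             stuck⇒minimal (suc p) (λ { refl bp≡false → contradiction (trans (sym bp) bp≡false) λ () }) noR

      descend-right : ∀ g m → g + m ≡ L → S m → NoLeftDescent m → Result (λ m′ m → m ≤ m′ × Run true m m′) m
      descend-right zero    m refl Sm _ = contradiction (bounded Sm) (<-irrefl refl)
      descend-right (suc g) m g+m≡L Sm noL with bit m in bm | S? (suc m)
      ... | true | yes S1+m =
        let m′ , (1+m≤m′ , T) , Sm′ , minimal =
              descend-right g (suc m) (trans (+-suc g m) g+m≡L) S1+m
                            (λ { refl bm≡false → contradiction (trans (sym bm) bm≡false) λ () })
        in m′ , (≤-trans (n≤1+n m) 1+m≤m′ , run-cons bm T) , Sm′ , minimal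
      ... | true  | no ¬S1+m = m , (≤-refl , run-empty ≤-refl) , Sm , stuck⇒minimal m noL (λ _ → ¬S1+m)
      ... | false | _        = m , (≤-refl , run-empty ≤-refl) , Sm ,
                               stuck⇒minimal m noL (λ bm≡true → contradiction (trans (sym bm) bm≡true) λ ())

      via-right : ∀ {x} → S x → NoLeftDescent x → Result _≼_ x
      via-right {x} Sx noL =
        let m , (x≤m , T) , rest = descend-right (L ∸ x) x (m∸n+n≡m (<⇒≤ (bounded Sx))) Sx noL
        in m , inj₂ (x≤m , T) , rest

    minimal-below : ∀ {x} → S x → ∃[ m ] m ≼ x × S m × Minimal S m
    minimal-below {zero}  Sx = via-right Sx (λ ())
    minimal-below {suc p} Sx with bit p in bp | S? p
    ... | false | yes Sp =
      let m , (m≤p , F) , rest = descend-left p Sp (λ bp≡true → contradiction (trans (sym bp) bp≡true) λ ())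
      in m , inj₁ (m≤n⇒m≤1+n m≤p , run-snoc F bp) , rest
    ... | false | no ¬Sp = via-right Sx (λ { refl _ → ¬Sp })
    ... | true  | _      = via-right Sx (λ { refl bp≡false → contradiction (trans (sym bp) bp≡false) λ () })

  Covers : ℕ → ℕ → ℕ → Set
  Covers L i j = i ≼ j × i ≢ j × (∀ {t} → t < L → i ≼ t → t ≼ j → t ≡ i ⊎ t ≡ j)

  squeezed : ∀ {i k t} → Adjacent i k → i ≼ t → t ≼ k → t ≡ i ⊎ t ≡ k
  squeezed {i} {k} {t} adj i≼t t≼k with <-cmp t i | <-cmp t k
  ... | tri≈ _ t≡i _ | _            = inj₁ t≡i
  ... | _            | tri≈ _ t≡k _ = inj₂ t≡k
  ... | tri< t<i _ _ | tri< t<k _ _ = ⊥-elim (not-below-both i≼t t≼k t<i t<k)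
  ... | tri> _ _ i<t | tri> _ _ k<t = ⊥-elim (not-above-both i≼t t≼k i<t k<t)
  ... | tri< t<i _ _ | tri> _ _ k<t = ⊥-elim (nothing-between k<t t<i (adjacent-sym adj))
  ... | tri> _ _ i<t | tri< t<k _ _ = ⊥-elim (nothing-between i<t t<k adj)

  covers-suc : ∀ {L i} → bit i ≡ false → Covers L i (suc i)
  covers-suc bi = ≼-suc bi , 1+n≢n ∘ sym , λ _ → squeezed (inj₁ refl)

  suc-covers : ∀ {L i} → bit i ≡ true → Covers L (suc i) i
  suc-covers bi = suc-≼ bi , 1+n≢n , λ _ → squeezed (inj₂ refl)

  covers⇒adjacent : ∀ {L i j} → i < L → j < L → Covers L i j → Adjacent i j
  covers⇒adjacent {i = i} {j} _ j<L (inj₁ (i≤j , F) , i≢j , between) with suc i ≟ j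
  ... | yes 1+i≡j = inj₁ 1+i≡j
  ... | no  1+i≢j with between (<-trans 1+i<j j<L) (≼-suc (F ≤-refl i<j)) (inj₁ (<⇒≤ 1+i<j , run-restrict (n≤1+n i) ≤-refl F))
    where
    i<j = ≤∧≢⇒< i≤j i≢j
    1+i<j = ≤∧≢⇒< i<j 1+i≢j
  ...   | inj₁ 1+i≡i = contradiction 1+i≡i 1+n≢n
  ...   | inj₂ 1+i≡j = contradiction 1+i≡j 1+i≢j
  covers⇒adjacent {i = i} {j} i<L _ (inj₂ (j≤i , T) , i≢j , between) with suc j ≟ i
  ... | yes 1+j≡i = inj₂ 1+j≡i
  ... | no  1+j≢i with between (<-trans 1+j<i i<L) (inj₂ (<⇒≤ 1+j<i , run-restrict (n≤1+n j) ≤-refl T)) (suc-≼ (T ≤-refl j<i))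
    where
    j<i = ≤∧≢⇒< j≤i (i≢j ∘ sym)
    1+j<i = ≤∧≢⇒< j<i 1+j≢i
  ...   | inj₁ 1+j≡i = contradiction 1+j≡i 1+j≢i
  ...   | inj₂ 1+j≡j = contradiction 1+j≡j 1+n≢n

-- Complementing the bits reverses the fence.
module _ (bit : ℕ → Bool) where
  open Fence bit
  private
    module Dual = Fence (λ t → not (bit t))

    dual⇒≽ : ∀ {i k} → i Dual.≼ k → k ≼ i
    dual⇒≽ (inj₁ (i≤k , F)) = inj₂ (i≤k , λ i≤t t<k → not-injective (F i≤t t<k))
    dual⇒≽ (inj₂ (k≤i , T)) = inj₁ (k≤i , λ k≤t t<i → not-injective (T k≤t t<i))

    ≽⇒dual : ∀ {i k} → k ≼ i → i Dual.≼ k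
    ≽⇒dual (inj₁ (k≤i , F)) = inj₂ (k≤i , λ k≤t t<i → cong not (F k≤t t<i))
    ≽⇒dual (inj₂ (i≤k , T)) = inj₁ (i≤k , λ i≤t t<k → cong not (T i≤t t<k))

  maximal-above : ∀ {S : Pred ℕ 0ℓ} → Decidable S → DownClosed S → ∀ {L} → (∀ {t} → S t → t < L) →
                  ∀ {x} → S x → ∃[ m ] x ≼ m × S m × Maximal S m
  maximal-above S? down bounded Sx =
    let m , m≼x , Sm , minimal = Dual.minimal-below S? (λ i≼k → down (dual⇒≽ i≼k)) bounded Sx
    in m , dual⇒≽ m≼x , Sm , λ m≼t St → minimal (≽⇒dual m≼t) St

-- Rigidity of paths

all<⇒≤ : ∀ {n m} → (∀ {i} → i < n → i < m) → n ≤ m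
all<⇒≤ {zero}  _ = z≤n
all<⇒≤ {suc n} h = h (n<1+n n)

module _ {L L′ : ℕ} (f : ℕ → ℕ)
         (f-range : ∀ {i} → i < L → f i < L′)
         (f-injective : ∀ {i j} → i < L → j < L → f i ≡ f j → i ≡ j)
         (f-surjective : ∀ {j} → j < L′ → ∃[ i ] i < L × f i ≡ j)
         (f-adjacent : ∀ {i} → suc i < L → Adjacent (f i) (f (suc i))) where

  private
    shorter : ∀ {i} → suc i < L → i < L
    shorter = <-trans (n<1+n _)

    2+n≢n : ∀ {n} → suc (suc n) ≢ n
    2+n≢n eq = <-irrefl (sym eq) (<-trans (n<1+n _) (n<1+n _))

    no-turn-up : ∀ {i} → suc (suc i) < L → suc (f i) ≡ f (suc i) → suc (f (suc i)) ≡ f (suc (suc i))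
    no-turn-up {i} lt up with f-adjacent lt
    ... | inj₁ up′   = up′
    ... | inj₂ down′ = contradiction (f-injective lt (shorter (shorter lt)) (suc-injective (trans down′ (sym up))))
                                     2+n≢n

    no-turn-down : ∀ {i} → suc (suc i) < L → suc (f (suc i)) ≡ f i → suc (f (suc (suc i))) ≡ f (suc i)
    no-turn-down {i} lt down with f-adjacent lt
    ... | inj₂ down′ = down′
    ... | inj₁ up′   = contradiction (f-injective lt (shorter (shorter lt)) (trans (sym up′) down))
                                     2+n≢n

    ascending : suc (f 0) ≡ f 1 → ∀ {i} → i < L → f i ≡ f 0 + i
    ascending up₀ {zero}  _  = sym (+-identityʳ _)
    ascending up₀ {suc i} lt = begin
      f (suc i)       ≡⟨ sym (steps i lt) ⟩
      suc (f i)       ≡⟨ cong suc (ascending up₀ (shorter lt)) ⟩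
      suc (f 0 + i)   ≡⟨ sym (+-suc _ i) ⟩
      f 0 + suc i     ∎
      where
      open ≡-Reasoning
      steps : ∀ i → suc i < L → suc (f i) ≡ f (suc i)
      steps zero    _  = up₀
      steps (suc i) lt = no-turn-up lt (steps i (shorter lt))

    descending : suc (f 1) ≡ f 0 → ∀ {i} → i < L → f i + i ≡ f 0
    descending down₀ {zero}  _  = +-identityʳ _
    descending down₀ {suc i} lt = begin
      f (suc i) + suc i   ≡⟨ +-suc _ i ⟩
      suc (f (suc i)) + i ≡⟨ cong (_+ i) (steps i lt) ⟩
      f i + i             ≡⟨ descending down₀ (shorter lt) ⟩
      f 0                 ∎
      where
      open ≡-Reasoning
      steps : ∀ i → suc i < L → suc (f (suc i)) ≡ f i
      steps zero    _  = down₀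
      steps (suc i) lt = no-turn-down lt (steps i (shorter lt))

    monotonic : (∀ {i} → i < L → f i ≡ f 0 + i) ⊎ (∀ {i} → i < L → f i + i ≡ f 0)
    monotonic with 1 <? L
    ... | yes 1<L = ⊎-map ascending descending (f-adjacent 1<L)
    ... | no  1≮L = inj₁ λ { {zero} _ → sym (+-identityʳ _) ; {suc _} lt → contradiction (≤-<-trans (s≤s z≤n) lt) 1≮L }

    ascending-rigid : (∀ {i} → i < L → f i ≡ f 0 + i) → L ≡ L′ × (∀ {i} → i < L → f i ≡ i)
    ascending-rigid ascends = L≡L′ , identity
      where
      identity : ∀ {i} → i < L → f i ≡ i
      identity {i} i<L =
        let i₀ , i₀<L , fi₀≡0 = f-surjective (≤-<-trans z≤n (f-range i<L))
        in trans (ascends i<L) (cong (_+ i) (m+n≡0⇒m≡0 _ (trans (sym (ascends i₀<L)) fi₀≡0)))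
      L≡L′ : L ≡ L′
      L≡L′ = ≤-antisym (all<⇒≤ λ i<L → subst (_< L′) (identity i<L) (f-range i<L))
                       (all<⇒≤ λ j<L′ → let i , i<L , fi≡j = f-surjective j<L′
                                        in subst (_< L) (trans (sym (identity i<L)) fi≡j) i<L)

    descending-rigid : (∀ {i} → i < L → f i + i ≡ f 0) → L ≡ L′ × (∀ {i} → i < L → f i + suc i ≡ L)
    descending-rigid descends = L≡L′ , reversal
      where
      below-f0 : ∀ {i} → i < L → i ≤ f 0
      below-f0 {i} i<L = subst (i ≤_) (descends i<L) (m≤n+m i (f i))
      preimage-bounded : ∀ {j} → j < L′ → j < L
      preimage-bounded j<L′ with f-surjective j<L′ | f-surjective (≤-<-trans z≤n j<L′)
      ... | i , i<L , refl | i₀ , i₀<L , fi₀≡0 =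
        ≤-<-trans (subst (f i ≤_) (descends i<L) (m≤m+n (f i) i))
                  (subst (_< L) (trans (cong (_+ i₀) (sym fi₀≡0)) (descends i₀<L)) i₀<L)
      L≡L′ : L ≡ L′
      L≡L′ = ≤-antisym (all<⇒≤ λ i<L → ≤-<-trans (below-f0 i<L) (f-range (≤-<-trans z≤n i<L))) (all<⇒≤ preimage-bounded)
      reversal : ∀ {i} → i < L → f i + suc i ≡ L
      reversal {i} i<L = begin
        f i + suc i   ≡⟨ +-suc (f i) i ⟩
        suc (f i + i) ≡⟨ cong suc (descends i<L) ⟩
        suc (f 0)     ≡⟨ ≤-antisym (subst (suc (f 0) ≤_) (sym L≡L′) (f-range (≤-<-trans z≤n i<L)))
                                   (all<⇒≤ (s≤s ∘ below-f0)) ⟩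
        L             ∎
        where open ≡-Reasoning

  path-rigid : L ≡ L′ × ((∀ {i} → i < L → f i ≡ i) ⊎ (∀ {i} → i < L → f i + suc i ≡ L))
  path-rigid with monotonic
  ... | inj₁ ascends  = map₂ inj₁ (ascending-rigid ascends)
  ... | inj₂ descends = map₂ inj₂ (descending-rigid descends)

-- Isomorphisms of labelled fences

infix 4 _≼⟨_⟩_
_≼⟨_⟩_ : ℕ → List Bool → ℕ → Set
i ≼⟨ B ⟩ k = Fence._≼_ (bitAt B) i k

record FenceIsomorphism (B B′ : List Bool) : Set where
  field
    to            : ℕ → ℕ
    from          : ℕ → ℕ
    to-range      : ∀ {i} → i < length B → to i < length B′
    from-range    : ∀ {j} → j < length B′ → from j < length B
    from-to       : ∀ {i} → i < length B → from (to i) ≡ i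
    to-from       : ∀ {j} → j < length B′ → to (from j) ≡ j
    to-monotone   : ∀ {i j} → i < length B → j < length B → i ≼⟨ B ⟩ j → to i ≼⟨ B′ ⟩ to j
    from-monotone : ∀ {i j} → i < length B′ → j < length B′ → i ≼⟨ B′ ⟩ j → from i ≼⟨ B ⟩ from j
    to-label      : ∀ {i} → i < length B → bitAt B′ (to i) ≡ bitAt B i

fenceIsomorphism-sym : ∀ {B B′} → FenceIsomorphism B B′ → FenceIsomorphism B′ B
fenceIsomorphism-sym {B} {B′} iso = record
  { to = from ; from = to ; to-range = from-range ; from-range = to-range ; from-to = to-from ; to-from = from-to
  ; to-monotone = from-monotone ; from-monotone = to-monotone
  ; to-label = λ j<L′ → trans (sym (to-label (from-range j<L′))) (cong (bitAt B′) (to-from j<L′))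
  }
  where open FenceIsomorphism iso

parity : ℕ → Bool
parity zero    = true
parity (suc n) = not (parity n)

bitAt-ext : ∀ {B B′} → length B ≡ length B′ → (∀ {i} → i < length B → bitAt B i ≡ bitAt B′ i) → B ≡ B′
bitAt-ext {[]}    {[]}     _   _    = refl
bitAt-ext {b ∷ B} {b′ ∷ B′} len same =
  cong₂ _∷_ (same (s≤s z≤n)) (bitAt-ext (suc-injective len) (same ∘ s≤s))

module _ {B B′ : List Bool} (iso : FenceIsomorphism B B′) where
  open FenceIsomorphism iso
  private
    module F  = Fence (bitAt B)
    module F′ = Fence (bitAt B′)

  to-injective : ∀ {i j} → i < length B → j < length B → to i ≡ to j → i ≡ j
  to-injective i<L j<L eq = trans (sym (from-to i<L)) (trans (cong from eq) (from-to j<L))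

  to-covers : ∀ {i j} → i < length B → j < length B → F.Covers (length B) i j → F′.Covers (length B′) (to i) (to j)
  to-covers {i} {j} i<L j<L (i≼j , i≢j , between) = to-monotone i<L j<L i≼j , i≢j ∘ to-injective i<L j<L , between′
    where
    between′ : ∀ {t} → t < length B′ → to i F′.≼ t → t F′.≼ to j → t ≡ to i ⊎ t ≡ to j
    between′ {t} t<L′ i≼t t≼j =
      ⊎-map (λ eq → trans (sym (to-from t<L′)) (cong to eq)) (λ eq → trans (sym (to-from t<L′)) (cong to eq))
            (between (from-range t<L′)
                     (subst (F._≼ from t) (from-to i<L) (from-monotone (to-range i<L) t<L′ i≼t))
                     (subst (from t F.≼_) (from-to j<L) (from-monotone t<L′ (to-range j<L) t≼j)))

  to-adjacent : ∀ {i} → suc i < length B → Adjacent (to i) (to (suc i))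
  to-adjacent {i} 1+i<L with bitAt B i in bi
  ... | false = F′.covers⇒adjacent (to-range i<L) (to-range 1+i<L) (to-covers i<L 1+i<L (F.covers-suc bi))
    where i<L = <-trans (n<1+n i) 1+i<L
  ... | true  = adjacent-sym (F′.covers⇒adjacent (to-range 1+i<L) (to-range i<L) (to-covers 1+i<L i<L (F.suc-covers bi)))
    where i<L = <-trans (n<1+n i) 1+i<L

  to-rigid : length B ≡ length B′ × ((∀ {i} → i < length B → to i ≡ i) ⊎ (∀ {i} → i < length B → to i + suc i ≡ length B))
  to-rigid = path-rigid to to-range to-injective (λ {j} j<L′ → from j , from-range j<L′ , to-from j<L′) to-adjacent

  -- A reversal turns every fence edge around but keeps its label, so consecutive bits differ.
  reversal-alternates : Canonical B′ → (∀ {i} → i < length B → to i + suc i ≡ length B′) →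
                        ∀ {i} → i < length B → bitAt B i ≡ parity i
  reversal-alternates canonical′ reversal {zero} 0<L =
    trans (sym (to-label 0<L)) (canonical-last B′ canonical′ (trans (+-comm 1 (to 0)) (reversal 0<L)))
  reversal-alternates canonical′ reversal {suc i} 1+i<L =
    trans alternation (cong not (reversal-alternates canonical′ reversal i<L))
    where
    i<L = <-trans (n<1+n i) 1+i<L
    to-step : to i ≡ suc (to (suc i))
    to-step = +-cancelʳ-≡ (suc i) _ _ (trans (reversal i<L) (trans (sym (reversal 1+i<L)) (+-suc (to (suc i)) (suc i))))
    alternation : bitAt B (suc i) ≡ not (bitAt B i)
    alternation with bitAt B i in bi
    ... | false = trans (sym (to-label 1+i<L)) (F′.suc-≼⁻¹ (subst (F′._≼ to (suc i)) to-step (to-monotone i<L 1+i<L (F.≼-suc bi))))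
    ... | true  = trans (sym (to-label 1+i<L)) (F′.≼-suc⁻¹ (subst (to (suc i) F′.≼_) to-step (to-monotone 1+i<L i<L (F.suc-≼ bi))))

fenceIsomorphism⇒≡ : ∀ {B B′} → Canonical B → Canonical B′ → FenceIsomorphism B B′ → B ≡ B′
fenceIsomorphism⇒≡ {B} {B′} canonical canonical′ iso with to-rigid iso
... | L≡L′ , inj₁ identity = bitAt-ext L≡L′ (λ i<L → trans (sym (to-label i<L)) (cong (bitAt B′) (identity i<L)))
  where open FenceIsomorphism iso
... | L≡L′ , inj₂ reversal = bitAt-ext L≡L′ λ i<L →
      trans (reversal-alternates iso canonical′ (subst (_ ≡_) L≡L′ ∘ reversal) i<L)
            (sym (reversal-alternates (fenceIsomorphism-sym iso) canonical inverse-reversal (subst (_ <_) L≡L′ i<L)))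
  where
  open FenceIsomorphism iso
  inverse-reversal : ∀ {j} → j < length B′ → from j + suc j ≡ length B
  inverse-reversal {j} j<L′ = begin
    from j + suc j             ≡⟨ +-comm (from j) (suc j) ⟩
    suc (j + from j)           ≡⟨ sym (+-suc j (from j)) ⟩
    j + suc (from j)           ≡⟨ cong (_+ suc (from j)) (sym (to-from j<L′)) ⟩
    to (from j) + suc (from j) ≡⟨ reversal (from-range j<L′) ⟩
    length B                   ∎
    where open ≡-Reasoning

-- Digits and carries

-- Digit d over binary bit b, taking carry x from the position below and passing carry y up.
CarryStep : Bool → Bool → Digit → Bool → Set
CarryStep b x d y = bitVal x + digitVal d ≡ bitVal b + double (bitVal y)

-- digitOf and carryOf solve CarryStep for the digit and for the outgoing carry; where no
-- solution exists they return junk.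
digitOf : Bool → Bool → Bool → Digit
digitOf false false false = d0
digitOf false false true  = d2
digitOf false true  true  = d1
digitOf true  false false = d1
digitOf true  true  false = d0
digitOf true  true  true  = d2
digitOf false true  false = d0
digitOf true  false true  = d0

carryOf : Bool → Bool → Digit → Bool
carryOf _     _ d0 = false
carryOf false x d1 = x
carryOf true  _ d1 = false
carryOf false _ d2 = true
carryOf true  x d2 = x

digitOf-step : ∀ b x y → Admissible b x y → CarryStep b x (digitOf b x y) y
digitOf-step false false false _ = refl
digitOf-step false false true  _ = refl
digitOf-step false true  true  _ = refl
digitOf-step true  false false _ = refl
digitOf-step true  true  false _ = refl
digitOf-step true  true  true  _ = refl

step-admissible : ∀ {b x d y} → CarryStep b x d y → Admissible b x y
step-admissible {false} {false} {_}  {false} _ = b≤b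
step-admissible {false} {false} {_}  {true}  _ = f≤t
step-admissible {false} {true}  {_}  {true}  _ = b≤b
step-admissible {true}  {false} {_}  {false} _ = b≤b
step-admissible {true}  {true}  {_}  {false} _ = f≤t
step-admissible {true}  {true}  {_}  {true}  _ = b≤b
step-admissible {false} {true}  {_}  {false} ()
step-admissible {true}  {false} {d0} {true}  ()
step-admissible {true}  {false} {d1} {true}  ()
step-admissible {true}  {false} {d2} {true}  ()

digitVal-injective : ∀ {d d′} → digitVal d ≡ digitVal d′ → d ≡ d′
digitVal-injective {d0} {d0} _ = refl
digitVal-injective {d1} {d1} _ = refl
digitVal-injective {d2} {d2} _ = refl

bitVal-injective : ∀ {x y} → bitVal x ≡ bitVal y → x ≡ y
bitVal-injective {false} {false} _ = refl
bitVal-injective {true}  {true}  _ = refl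

step-digit : ∀ {b x d y} → CarryStep b x d y → digitOf b x y ≡ d
step-digit {b} {x} {d} {y} step =
  digitVal-injective (+-cancelˡ-≡ (bitVal x) _ _ (trans (digitOf-step b x y (step-admissible step)) (sym step)))

carry-split : ∀ b x d v F → bitVal x + (digitVal d + double v) ≡ bitVal b + double F →
              CarryStep b x d (carryOf b x d) × bitVal (carryOf b x d) + v ≡ F
carry-split false false d0 v F eq = refl , double-injective eq
carry-split true  true  d0 v F eq = refl , double-injective (suc-injective eq)
carry-split true  false d1 v F eq = refl , double-injective (suc-injective eq)
carry-split false true  d1 v F eq = refl , double-injective eq
carry-split false false d2 v F eq = refl , double-injective eq
carry-split true  true  d2 v F eq = refl , double-injective (suc-injective eq)
carry-split false true  d0 v F eq = contradiction (sym eq) (double≢suc-double F v)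
carry-split true  false d0 v F eq = contradiction eq (double≢suc-double v F)
carry-split false false d1 v F eq = contradiction (sym eq) (double≢suc-double F v)
carry-split true  true  d1 v F eq = contradiction (sym (suc-injective eq)) (double≢suc-double F v)
carry-split false true  d2 v F eq = contradiction (sym eq) (double≢suc-double F (suc v))
carry-split true  false d2 v F eq = contradiction (sym (suc-injective eq)) (double≢suc-double F v)

lsbValue : List Digit → ℕ
lsbValue []       = 0
lsbValue (d ∷ ds) = digitVal d + double (lsbValue ds)

Represents : List Bool → Bool → List Digit → Set
Represents bs c ds = bitVal c + lsbValue ds ≡ bitsValue bs

Nonzero : Digit → Set
Nonzero d0 = ⊥
Nonzero d1 = ⊤
Nonzero d2 = ⊤

topDigit : Digit → List Digit
topDigit d0 = []
topDigit d1 = d1 ∷ []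
topDigit d2 = d2 ∷ []

head₀ : List Digit → Digit
head₀ []      = d0
head₀ (d ∷ _) = d

tail₀ : List Digit → List Digit
tail₀ []       = []
tail₀ (_ ∷ ds) = ds

digitsOf : List Bool → (ℕ → Bool) → List Digit
digitsOf []            c = []
digitsOf (b ∷ [])      c = topDigit (digitOf b (c 0) (c 1))
digitsOf (b ∷ b′ ∷ bs) c = digitOf b (c 0) (c 1) ∷ digitsOf (b′ ∷ bs) (c ∘ suc)

carriesOf : List Bool → Bool → List Digit → ℕ → Bool
carriesOf bs       c ds zero    = c
carriesOf []       c ds (suc i) = false
carriesOf (b ∷ bs) c ds (suc i) = carriesOf bs (carryOf b c (head₀ ds)) (tail₀ ds) i

Carries : List Bool → (ℕ → Bool) → Set
Carries bs c = Fence.EdgeMonotone (bitAt bs) c × (∀ {i} → length bs ≤ i → c i ≡ false)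

carries-suc : ∀ {b bs c} → Carries (b ∷ bs) c → Carries bs (c ∘ suc)
carries-suc (edge , bounded) = edge ∘ suc , bounded ∘ s≤s

step-carry : ∀ b x d y → CarryStep b x d y → carryOf b x d ≡ y
step-carry b x d y step =
  bitVal-injective (trans (sym (+-identityʳ _))
    (proj₂ (carry-split b x d 0 (bitVal y) (trans (cong (bitVal x +_) (+-identityʳ (digitVal d))) step))))

lsbValue-split : ∀ ds → lsbValue ds ≡ digitVal (head₀ ds) + double (lsbValue (tail₀ ds))
lsbValue-split []      = refl
lsbValue-split (_ ∷ _) = refl

represents-split : ∀ b bs c ds → Represents (b ∷ bs) c ds →
                   CarryStep b c (head₀ ds) (carryOf b c (head₀ ds)) × Represents bs (carryOf b c (head₀ ds)) (tail₀ ds)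
represents-split b bs c ds rep =
  carry-split b c (head₀ ds) (lsbValue (tail₀ ds)) (bitsValue bs) (trans (cong (bitVal c +_) (sym (lsbValue-split ds))) rep)

lsbValue-topDigit : ∀ d → lsbValue (topDigit d) ≡ digitVal d
lsbValue-topDigit d0 = refl
lsbValue-topDigit d1 = refl
lsbValue-topDigit d2 = refl

head₀-topDigit : ∀ d → head₀ (topDigit d) ≡ d
head₀-topDigit d0 = refl
head₀-topDigit d1 = refl
head₀-topDigit d2 = refl

digitsOf-value : ∀ bs c → Carries bs c → Represents bs (c 0) (digitsOf bs c)
digitsOf-value [] c (_ , bounded) rewrite bounded {0} z≤n = refl
digitsOf-value (b ∷ []) c (edge , bounded) = begin
  bitVal (c 0) + lsbValue (topDigit (digitOf b (c 0) (c 1))) ≡⟨ cong (bitVal (c 0) +_) (lsbValue-topDigit _) ⟩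
  bitVal (c 0) + digitVal (digitOf b (c 0) (c 1))             ≡⟨ digitOf-step b (c 0) (c 1) (edge 0) ⟩
  bitVal b + double (bitVal (c 1))                             ≡⟨ cong (λ y → bitVal b + double (bitVal y)) (bounded (s≤s z≤n)) ⟩
  bitVal b + 0                                                 ∎
  where open ≡-Reasoning
digitsOf-value (b ∷ b′ ∷ bs) c carries@(edge , _) = begin
  bitVal (c 0) + (digitVal d + double R)    ≡⟨ sym (+-assoc (bitVal (c 0)) _ _) ⟩
  bitVal (c 0) + digitVal d + double R      ≡⟨ cong (_+ double R) (digitOf-step b (c 0) (c 1) (edge 0)) ⟩
  bitVal b + double (bitVal (c 1)) + double R ≡⟨ +-assoc (bitVal b) _ _ ⟩
  bitVal b + (double (bitVal (c 1)) + double R) ≡⟨ cong (bitVal b +_) (sym (double-+ (bitVal (c 1)) R)) ⟩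
  bitVal b + double (bitVal (c 1) + R)      ≡⟨ cong (λ v → bitVal b + double v) (digitsOf-value (b′ ∷ bs) (c ∘ suc) (carries-suc carries)) ⟩
  bitVal b + double (bitsValue (b′ ∷ bs))   ∎
  where
  open ≡-Reasoning
  d = digitOf b (c 0) (c 1)
  R = lsbValue (digitsOf (b′ ∷ bs) (c ∘ suc))

carriesOf-carries : ∀ bs c ds → Represents bs c ds → Carries bs (carriesOf bs c ds)
carriesOf-carries [] false ds _ = (λ { zero → b≤b ; (suc _) → b≤b }) , λ { {zero} _ → refl ; {suc _} _ → refl }
carriesOf-carries (b ∷ bs) c ds rep =
  let step , rep′ = represents-split b bs c ds rep
      edge , bounded = carriesOf-carries bs _ (tail₀ ds) rep′
  in (λ { zero → step-admissible step ; (suc i) → edge i }) , λ { {suc i} (s≤s len≤i) → bounded len≤i }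

carryOf-digitOf : ∀ b x y → Admissible b x y → carryOf b x (digitOf b x y) ≡ y
carryOf-digitOf b x y adm = step-carry b x (digitOf b x y) y (digitOf-step b x y adm)

carriesOf-digitsOf : ∀ bs c → Carries bs c → ∀ i → carriesOf bs (c 0) (digitsOf bs c) i ≡ c i
carriesOf-digitsOf bs c _ zero = refl
carriesOf-digitsOf [] c (_ , bounded) (suc i) = sym (bounded z≤n)
carriesOf-digitsOf (b ∷ []) c (edge , bounded) (suc zero) =
  trans (cong (carryOf b (c 0)) (head₀-topDigit _)) (carryOf-digitOf b (c 0) (c 1) (edge 0))
carriesOf-digitsOf (b ∷ []) c (_ , bounded) (suc (suc i)) = sym (bounded (s≤s z≤n))
carriesOf-digitsOf (b ∷ b′ ∷ bs) c carries@(edge , _) (suc i) =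
  trans (cong (λ y → carriesOf (b′ ∷ bs) y (digitsOf (b′ ∷ bs) (c ∘ suc)) i) (carryOf-digitOf b (c 0) (c 1) (edge 0)))
        (carriesOf-digitsOf (b′ ∷ bs) (c ∘ suc) (carries-suc carries) i)

carry-bound : ∀ b c F → bitVal c + 0 ≡ bitVal b + double F → F ≡ 0
carry-bound _     _     zero    _ = refl
carry-bound false false (suc _) ()
carry-bound false true  (suc _) ()
carry-bound true  false (suc _) ()
carry-bound true  true  (suc _) ()

lastNonzero-value : ∀ d ds → Last Nonzero (d ∷ ds) → lsbValue (d ∷ ds) ≢ 0
lastNonzero-value d1 []       _ ()
lastNonzero-value d2 []       _ ()
lastNonzero-value d  (d′ ∷ ds) p eq = lastNonzero-value d′ ds p (double-injective (m+n≡0⇒n≡0 (digitVal d) eq))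

digitsOf-carriesOf : ∀ b bs c ds → Canonical bs → Represents (b ∷ bs) c ds → Last Nonzero ds →
                     digitsOf (b ∷ bs) (carriesOf (b ∷ bs) c ds) ≡ ds
digitsOf-carriesOf b [] c ds _ rep last =
  let step , rep′ = represents-split b [] c ds rep
  in trans (cong topDigit (step-digit step)) (single ds last (m+n≡0⇒n≡0 (bitVal (carryOf b c (head₀ ds))) rep′))
  where
  single : ∀ ds → Last Nonzero ds → lsbValue (tail₀ ds) ≡ 0 → topDigit (head₀ ds) ≡ ds
  single []            _    _    = refl
  single (d1 ∷ [])     _    _    = refl
  single (d2 ∷ [])     _    _    = refl
  single (_ ∷ d ∷ ds)  last tail≡0 = contradiction tail≡0 (lastNonzero-value d ds last)
digitsOf-carriesOf b (b′ ∷ bs) c [] canonical rep _ =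
  contradiction (carry-bound b c _ rep) (canonical-nonzero b′ bs canonical)
digitsOf-carriesOf b (b′ ∷ bs) c (d ∷ ds) canonical rep last =
  let step , rep′ = represents-split b (b′ ∷ bs) c (d ∷ ds) rep
  in cong₂ _∷_ (step-digit step) (digitsOf-carriesOf b′ bs (carryOf b c d) ds (last-tail b′ bs canonical) rep′ (last-tail d ds last))

digitsOf-empty : ∀ b bs c → Canonical (b ∷ bs) → Carries (b ∷ bs) c → digitsOf (b ∷ bs) c ≡ [] → c 0 ≡ true
digitsOf-empty true [] c _ (_ , bounded) empty = top (c 0) (c 1) (bounded (s≤s z≤n)) empty
  where
  top : ∀ x y → y ≡ false → topDigit (digitOf true x y) ≡ [] → x ≡ true
  top true  _     _ _ = refl
  top false false _ ()

digitsOf-lastNonzero : ∀ b bs c → Canonical bs → Carries (b ∷ bs) c → Last Nonzero (digitsOf (b ∷ bs) c)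
digitsOf-lastNonzero b [] c _ _ = top (digitOf b (c 0) (c 1))
  where
  top : ∀ d → Last Nonzero (topDigit d)
  top d0 = tt
  top d1 = tt
  top d2 = tt
digitsOf-lastNonzero b (b′ ∷ bs) c canonical carries@(edge , _) =
  last-cons _ _ (digitsOf-lastNonzero b′ bs (c ∘ suc) (last-tail b′ bs canonical) (carries-suc carries))
    λ empty → subst (λ y → Admissible b (c 0) y → Nonzero (digitOf b (c 0) y))
                    (sym (digitsOf-empty b′ bs (c ∘ suc) canonical (carries-suc carries) empty))
                    (nonzero b (c 0)) (edge 0)
  where
  nonzero : ∀ b x → Admissible b x true → Nonzero (digitOf b x true)
  nonzero false false _ = tt
  nonzero false true  _ = tt
  nonzero true  true  _ = tt

value-reverse : ∀ ds → value (reverse ds) ≡ lsbValue ds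
value-reverse []       = refl
value-reverse (d ∷ ds) = begin
  value (reverse (d ∷ ds))                 ≡⟨ cong value (unfold-reverse d ds) ⟩
  value (reverse ds ∷ʳ d)                  ≡⟨ foldl-∷ʳ _ 0 d (reverse ds) ⟩
  2 * value (reverse ds) + digitVal d      ≡⟨ +-comm _ (digitVal d) ⟩
  digitVal d + 2 * value (reverse ds)      ≡⟨ cong (λ v → digitVal d + v) (sym (double≡2* _)) ⟩
  digitVal d + double (value (reverse ds)) ≡⟨ cong (λ v → digitVal d + double v) (value-reverse ds) ⟩
  lsbValue (d ∷ ds)                        ∎
  where open ≡-Reasoning

leadingNonzero-reverse : ∀ ds → LeadingNonzero (reverse ds) ≡ Last Nonzero ds
leadingNonzero-reverse []            = refl
leadingNonzero-reverse (d0 ∷ [])     = refl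
leadingNonzero-reverse (d1 ∷ [])     = refl
leadingNonzero-reverse (d2 ∷ [])     = refl
leadingNonzero-reverse (d ∷ d′ ∷ ds) = begin
  LeadingNonzero (reverse (d ∷ d′ ∷ ds))         ≡⟨ cong LeadingNonzero (unfold-reverse d (d′ ∷ ds)) ⟩
  LeadingNonzero (reverse (d′ ∷ ds) ++ d ∷ [])  ≡⟨ leading-++ (reverse (d′ ∷ ds)) (reverse-nonempty d′ ds) ⟩
  LeadingNonzero (reverse (d′ ∷ ds))             ≡⟨ leadingNonzero-reverse (d′ ∷ ds) ⟩
  Last Nonzero (d′ ∷ ds)                         ∎
  where
  open ≡-Reasoning
  leading-++ : ∀ xs {ys} → xs ≢ [] → LeadingNonzero (xs ++ ys) ≡ LeadingNonzero xs
  leading-++ []        []≢[] = contradiction refl []≢[]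
  leading-++ (d0 ∷ _)  _     = refl
  leading-++ (d1 ∷ _)  _     = refl
  leading-++ (d2 ∷ _)  _     = refl
  reverse-nonempty : ∀ x xs → reverse (x ∷ xs) ≢ []
  reverse-nonempty x xs eq with trans (sym (reverse-involutive (x ∷ xs))) (cong reverse eq)
  ... | ()

-- Arcs lower a single carry

Edge : Bool → Word → Word → Set
Edge true  = Arrow
Edge false = DArrow

data Move : Digit → Digit → Bool → Set where
  arrow  : Move d0 d1 true
  darrow : Move d1 d2 false

move-edge : ∀ {p q l} → Move p q l → ∀ x y → Edge l (x ++ p ∷ d2 ∷ y) (x ++ q ∷ d0 ∷ y)
move-edge arrow  = inner
move-edge darrow = inner

LoweredAt : ℕ → (ℕ → Bool) → (ℕ → Bool) → Set
LoweredAt k f g = f k ≡ true × g k ≡ false × (∀ {i} → i ≢ k → f i ≡ g i)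

lowered-suc : ∀ {k f g} → f 0 ≡ g 0 → LoweredAt k (f ∘ suc) (g ∘ suc) → LoweredAt (suc k) f g
lowered-suc f0≡g0 (fk , gk , same) = fk , gk , λ { {zero} _ → f0≡g0 ; {suc i} i≢k → same (i≢k ∘ cong suc) }

lowered-pred : ∀ {k f g} → LoweredAt (suc k) f g → LoweredAt k (f ∘ suc) (g ∘ suc)
lowered-pred (fk , gk , same) = fk , gk , λ i≢k → same (i≢k ∘ suc-injective)

lowered-cong : ∀ {k f f′ g g′} → f ≗ f′ → g ≗ g′ → LoweredAt k f g → LoweredAt k f′ g′
lowered-cong f≗f′ g≗g′ (fk , gk , same) =
  trans (sym (f≗f′ _)) fk , trans (sym (g≗g′ _)) gk , λ i≢k → trans (sym (f≗f′ _)) (trans (same i≢k) (g≗g′ _))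

update-lowered : ∀ {k d} → d k ≡ true → LoweredAt k d (update k false d)
update-lowered {k} {d} dk = dk , update-same k false d , λ i≢k → sym (update-other false d i≢k)

update-raised : ∀ {k d} → d k ≡ false → LoweredAt k (update k true d) d
update-raised {k} {d} dk = update-same k true d , dk , λ i≢k → update-other true d i≢k

lowered-≤ : ∀ {k f g} → LoweredAt k f g → ∀ i → g i 𝔹.≤ f i
lowered-≤ {k} (fk , gk , same) i with i ≟ k
... | yes refl rewrite fk | gk = f≤t
... | no  i≢k  = ≤ᵇ-reflexive (sym (same i≢k))

lowered⇒update : ∀ {k d d′} → LoweredAt k d d′ → d ≗ update k true d′
lowered⇒update {k} {d} {d′} (dk , _ , same) i with i ≟ k
... | yes refl = dk
... | no  i≢k  = same i≢k

count : (ℕ → Bool) → ℕ → ℕ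
count f zero    = 0
count f (suc n) = bitVal (f n) + count f n

count-lowered : ∀ {k d d′} n → LoweredAt k d d′ → k < n → count d n ≡ suc (count d′ n)
count-lowered {k} {d} {d′} (suc n) (dk , d′k , same) k<1+n with k ≟ n
... | yes refl rewrite dk | d′k = cong suc (count-same n (λ i<n → same (<⇒≢ i<n)))
  where
  count-same : ∀ n → (∀ {i} → i < n → d i ≡ d′ i) → count d n ≡ count d′ n
  count-same zero    _    = refl
  count-same (suc n) same′ = cong₂ _+_ (cong bitVal (same′ ≤-refl)) (count-same n (same′ ∘ m<n⇒m<1+n))
... | no k≢n rewrite same {n} (k≢n ∘ sym) =
  trans (cong (bitVal (d′ n) +_) (count-lowered n (dk , d′k , same) (≤∧≢⇒< (≤-pred k<1+n) k≢n))) (+-suc _ _)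

two-apart : ∀ b x y y′ → CarryStep b x d2 y → CarryStep b x d0 y′ → y ≡ true × y′ ≡ false
two-apart _     _     true  false _  _  = refl , refl
two-apart false false false _     () _
two-apart false true  false _     () _
two-apart true  false false _     () _
two-apart true  true  false _     () _
two-apart false false true  true  _  ()
two-apart false true  true  true  _  ()
two-apart true  false true  true  _  ()
two-apart true  true  true  true  _  ()

move-label : ∀ {p q l} → Move p q l → ∀ b y → CarryStep b true p y → b ≡ l
move-label arrow  true  _     _  = refl
move-label arrow  false false ()
move-label arrow  false true  ()
move-label darrow false _     _  = refl
move-label darrow true  false ()
move-label darrow true  true  ()

move-lowered-base : ∀ {p q l} → Move p q l → ∀ X bs c → Represents bs c (d2 ∷ p ∷ X) → Represents bs c (d0 ∷ q ∷ X) →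
                    LoweredAt 1 (carriesOf bs c (d2 ∷ p ∷ X)) (carriesOf bs c (d0 ∷ q ∷ X)) × bitAt bs 1 ≡ l
move-lowered-base mv X [] false () _
move-lowered-base mv X [] true  () _
move-lowered-base {p} {q} mv X (b ∷ bs) c repP repQ
  with represents-split b bs c (d2 ∷ p ∷ X) repP | represents-split b bs c (d0 ∷ q ∷ X) repQ
... | step₁ , repP₁ | step₁′ , repQ₁
  with two-apart b c (carryOf b c d2) (carryOf b c d0) step₁ step₁′
... | y₁≡true , y₁′≡false with bs
...   | [] = contradiction (trans (cong (λ y → bitVal y + _) (sym y₁≡true)) repP₁) λ ()
...   | b′ ∷ bs′ =
  let step₂ , repP₂ = represents-split b′ bs′ (carryOf b c d2) (p ∷ X) repP₁
      _     , repQ₂ = represents-split b′ bs′ (carryOf b c d0) (q ∷ X) repQ₁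
      y₂≡y₂′ = bitVal-injective (+-cancelʳ-≡ (lsbValue X) _ _ (trans repP₂ (sym repQ₂)))
      y₂ = carryOf b′ (carryOf b c d2) p
  in (y₁≡true , y₁′≡false , λ { {zero} _ → refl
                               ; {suc zero} 1≢1 → contradiction refl 1≢1
                               ; {suc (suc j)} _ → cong (λ y → carriesOf bs′ y X j) y₂≡y₂′ })
     , move-label mv b′ y₂ (subst (λ y → CarryStep b′ y p y₂) y₁≡true step₂)

represents-tail-zero : ∀ c d ds → Represents [] c (d ∷ ds) → Represents [] false ds
represents-tail-zero c d ds rep =
  double-injective {lsbValue ds} {0} (m+n≡0⇒n≡0 (digitVal d) (m+n≡0⇒n≡0 (bitVal c) rep))

module _ {P Q : List Digit} {l : Bool}
         (base : ∀ bs c → Represents bs c P → Represents bs c Q →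
                 LoweredAt 1 (carriesOf bs c P) (carriesOf bs c Q) × bitAt bs 1 ≡ l) where

  lowered-after : ∀ ys bs c → Represents bs c (ys ++ P) → Represents bs c (ys ++ Q) →
                  LoweredAt (suc (length ys)) (carriesOf bs c (ys ++ P)) (carriesOf bs c (ys ++ Q)) × bitAt bs (suc (length ys)) ≡ l
  lowered-after []       bs       c repP repQ = base bs c repP repQ
  lowered-after (d ∷ ys) []       c repP repQ
    with lowered-after ys [] false (represents-tail-zero c d (ys ++ P) repP) (represents-tail-zero c d (ys ++ Q) repQ)
  ... | (() , _) , _
  lowered-after (d ∷ ys) (b ∷ bs) c repP repQ =
    let lowered , label = lowered-after ys bs (carryOf b c d) (proj₂ (represents-split b bs c (d ∷ ys ++ P) repP))
                                                             (proj₂ (represents-split b bs c (d ∷ ys ++ Q) repQ))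
    in lowered-suc refl lowered , label

reverse-pair : ∀ (x : List Digit) a b y → reverse (x ++ a ∷ b ∷ y) ≡ reverse y ++ b ∷ a ∷ reverse x
reverse-pair x a b y = begin
  reverse (x ++ a ∷ b ∷ y)                         ≡⟨ reverse-++ x (a ∷ b ∷ y) ⟩
  reverse (a ∷ b ∷ y) ++ reverse x                 ≡⟨ cong (_++ reverse x) (trans (unfold-reverse a (b ∷ y)) (cong (_∷ʳ a) (unfold-reverse b y))) ⟩
  ((reverse y ++ b ∷ []) ++ a ∷ []) ++ reverse x   ≡⟨ cong (_++ reverse x) (++-assoc (reverse y) (b ∷ []) (a ∷ [])) ⟩
  (reverse y ++ b ∷ a ∷ []) ++ reverse x           ≡⟨ ++-assoc (reverse y) (b ∷ a ∷ []) (reverse x) ⟩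
  reverse y ++ b ∷ a ∷ reverse x                   ∎
  where open ≡-Reasoning

LowersSomewhere : List Bool → Bool → List Digit → List Digit → Bool → Set
LowersSomewhere bs c ds ds′ l = ∃[ k ] LoweredAt (suc k) (carriesOf bs c ds) (carriesOf bs c ds′) × bitAt bs (suc k) ≡ l

move-lowered : ∀ {p q l} → Move p q l → ∀ x y bs c →
               Represents bs c (reverse (x ++ p ∷ d2 ∷ y)) → Represents bs c (reverse (x ++ q ∷ d0 ∷ y)) →
               LowersSomewhere bs c (reverse (x ++ p ∷ d2 ∷ y)) (reverse (x ++ q ∷ d0 ∷ y)) l
move-lowered {p} {q} mv x y bs c rewrite reverse-pair x p d2 y | reverse-pair x q d0 y =
  λ repP repQ → length (reverse y) , lowered-after (move-lowered-base mv (reverse x)) (reverse y) bs c repP repQ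

carriesOf-padded : ∀ bs c ds → carriesOf bs c (ds ++ d0 ∷ []) ≗ carriesOf bs c ds
carriesOf-padded bs       c []       zero    = refl
carriesOf-padded []       c []       (suc i) = refl
carriesOf-padded (b ∷ bs) c []       (suc i) = refl
carriesOf-padded bs       c (d ∷ ds) zero    = refl
carriesOf-padded []       c (d ∷ ds) (suc i) = refl
carriesOf-padded (b ∷ bs) c (d ∷ ds) (suc i) = carriesOf-padded bs (carryOf b c d) ds i

lsbValue-padded : ∀ ds → lsbValue (ds ++ d0 ∷ []) ≡ lsbValue ds
lsbValue-padded []       = refl
lsbValue-padded (d ∷ ds) = cong (λ v → digitVal d + double v) (lsbValue-padded ds)

edge⇒lowered : ∀ {l u w} bs c → Edge l u w → Represents bs c (reverse u) → Represents bs c (reverse w) →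
              LowersSomewhere bs c (reverse u) (reverse w) l
edge⇒lowered {true}  bs c (inner x y) = move-lowered arrow x y bs c
edge⇒lowered {false} bs c (inner x y) = move-lowered darrow x y bs c
-- 2y ↦ 10y is the inner rule applied to 02y, and a leading zero does not change the carries.
edge⇒lowered {true}  bs c (front y) repP repQ =
  let k , lowered , label = move-lowered arrow [] y bs c (subst (Represents bs c) (sym padded) repP′) repQ
  in k , lowered-cong padded-carries (λ _ → refl) lowered , label
  where
  padded : reverse (d0 ∷ d2 ∷ y) ≡ reverse (d2 ∷ y) ++ d0 ∷ []
  padded = unfold-reverse d0 (d2 ∷ y)
  repP′ : Represents bs c (reverse (d2 ∷ y) ++ d0 ∷ [])
  repP′ = trans (cong (bitVal c +_) (lsbValue-padded (reverse (d2 ∷ y)))) repP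
  padded-carries : carriesOf bs c (reverse (d0 ∷ d2 ∷ y)) ≗ carriesOf bs c (reverse (d2 ∷ y))
  padded-carries i = trans (cong (λ ds → carriesOf bs c ds i) padded) (carriesOf-padded bs c (reverse (d2 ∷ y)) i)

edge-++ : ∀ {l u w} z → Edge l u w → Edge l (u ++ z) (w ++ z)
edge-++ {true}  z (inner x y) = subst₂ Arrow (sym (++-assoc x _ z)) (sym (++-assoc x _ z)) (inner x (y ++ z))
edge-++ {true}  z (front y)   = front (y ++ z)
edge-++ {false} z (inner x y) = subst₂ DArrow (sym (++-assoc x _ z)) (sym (++-assoc x _ z)) (inner x (y ++ z))

edge-∷ : ∀ {l} d ds ds′ → Edge l (reverse ds) (reverse ds′) → Edge l (reverse (d ∷ ds)) (reverse (d ∷ ds′))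
edge-∷ d ds ds′ e = subst₂ (Edge _) (sym (unfold-reverse d ds)) (sym (unfold-reverse d ds′)) (edge-++ (d ∷ []) e)

digitsOf-cong : ∀ bs {c c′} → c ≗ c′ → digitsOf bs c ≡ digitsOf bs c′
digitsOf-cong []            c≗c′ = refl
digitsOf-cong (b ∷ [])      c≗c′ = cong₂ (λ x y → topDigit (digitOf b x y)) (c≗c′ 0) (c≗c′ 1)
digitsOf-cong (b ∷ b′ ∷ bs) c≗c′ =
  cong₂ _∷_ (cong₂ (digitOf b) (c≗c′ 0) (c≗c′ 1)) (digitsOf-cong (b′ ∷ bs) (c≗c′ ∘ suc))

lowered-digits : ∀ b x → Admissible b x true → Admissible b x false → digitOf b x true ≡ d2 × digitOf b x false ≡ d0
lowered-digits false false _ _  = refl , refl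
lowered-digits true  true  _ _  = refl , refl
lowered-digits false true  _ ()
lowered-digits true  false () _

second-move : ∀ b y → Admissible b true y → Admissible b false y → Move (digitOf b true y) (digitOf b false y) b
second-move false true  _ _  = darrow
second-move true  false _ _  = arrow
second-move false false () _
second-move true  true  _ ()

top-move : ∀ b bs c c′ → Carries (b ∷ bs) c → Carries (b ∷ bs) c′ →
           c 0 ≡ true → c′ 0 ≡ false → (∀ i → c (suc i) ≡ c′ (suc i)) →
           Edge b (reverse (d2 ∷ digitsOf (b ∷ bs) c)) (reverse (d0 ∷ digitsOf (b ∷ bs) c′))
top-move b [] c c′ (edge , bounded) (_ , bounded′) c0 c′0 _
  rewrite c0 | c′0 | bounded {1} (s≤s z≤n) | bounded′ {1} (s≤s z≤n) =
  single b (subst₂ (Admissible b) c0 (bounded (s≤s z≤n)) (edge 0))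
  where
  single : ∀ b → Admissible b true false →
           Edge b (reverse (d2 ∷ topDigit (digitOf b true false))) (reverse (d0 ∷ topDigit (digitOf b false false)))
  single true _ = front []
top-move b (b′ ∷ bs) c c′ (edge , _) (edge′ , _) c0 c′0 same
  rewrite c0 | c′0 | sym (same 0) | digitsOf-cong (b′ ∷ bs) same =
  subst₂ (Edge b) (sym (reverse-pair [] d2 _ rest)) (sym (reverse-pair [] d0 _ rest))
         (move-edge (second-move b (c 1) (subst (λ x → Admissible b x (c 1)) c0 (edge 0))
                                         (subst₂ (Admissible b) c′0 (sym (same 0)) (edge′ 0)))
                    (reverse rest) [])
  where rest = digitsOf (b′ ∷ bs) (c′ ∘ suc)

lowered⇒edge : ∀ bs c c′ k → Carries bs c → Carries bs c′ → LoweredAt (suc k) c c′ →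
              Edge (bitAt bs (suc k)) (reverse (digitsOf bs c)) (reverse (digitsOf bs c′))
lowered⇒edge [] c _ _ (_ , bounded) _ (ck , _) = contradiction (trans (sym ck) (bounded z≤n)) λ ()
lowered⇒edge (_ ∷ []) c _ _ (_ , bounded) _ (ck , _) = contradiction (trans (sym ck) (bounded (s≤s z≤n))) λ ()
lowered⇒edge (b ∷ b′ ∷ bs) c c′ zero carries@(edge , _) carries′@(edge′ , _) (c1 , c′1 , same) =
  let c0≡c′0 = same {0} (λ ())
      to-d2 , to-d0 = lowered-digits b (c 0) (subst (Admissible b (c 0)) c1 (edge 0))
                                             (subst₂ (Admissible b) (sym c0≡c′0) c′1 (edge′ 0))
  in subst₂ (λ x y → Edge b′ (reverse (x ∷ digitsOf (b′ ∷ bs) (c ∘ suc))) (reverse (y ∷ digitsOf (b′ ∷ bs) (c′ ∘ suc))))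
            (trans (sym to-d2) (cong (digitOf b (c 0)) (sym c1)))
            (trans (sym to-d0) (cong₂ (digitOf b) c0≡c′0 (sym c′1)))
            (top-move b′ bs (c ∘ suc) (c′ ∘ suc) (carries-suc carries) (carries-suc carries′) c1 c′1
                      (λ i → same {suc (suc i)} (λ ())))
lowered⇒edge (b ∷ b′ ∷ bs) c c′ (suc k) carries carries′ lowered@(_ , _ , same) =
  subst (λ x → Edge (bitAt bs k) (reverse (digitOf b (c 0) (c 1) ∷ tail)) (reverse (x ∷ tail′)))
        (cong₂ (digitOf b) (same {0} (λ ())) (same {1} (λ ())))
        (edge-∷ _ tail tail′ (lowered⇒edge (b′ ∷ bs) (c ∘ suc) (c′ ∘ suc) k (carries-suc carries) (carries-suc carries′)
                                           (lowered-pred lowered)))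
  where
  tail  = digitsOf (b′ ∷ bs) (c ∘ suc)
  tail′ = digitsOf (b′ ∷ bs) (c′ ∘ suc)

-- Hyperbinary expansions of an even number as monotone carry vectors

H-≡ : ∀ {n} {u w : H n} → proj₁ u ≡ proj₁ w → u ≡ w
H-≡ {u = w , p , e} {.w , p′ , e′} refl = cong₂ (λ x y → w , x , y) (leading-irrelevant w p p′) (≡-irrelevant e e′)
  where
  leading-irrelevant : ∀ w (p q : LeadingNonzero w) → p ≡ q
  leading-irrelevant []       _  _  = refl
  leading-irrelevant (d1 ∷ _) _  _  = refl
  leading-irrelevant (d2 ∷ _) _  _  = refl

Arc : ∀ {n} → Bool → H n → H n → Set
Arc l u w = Edge l (proj₁ u) (proj₁ w)

Reach : ∀ {n} → H n → H n → Set
Reach = Star (λ u w → ∃[ l ] Arc l u w)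

UniquePredecessor : ∀ {n} → H n → Set
UniquePredecessor v = ∃[ u ] ∃[ l ] Arc l u v × (∀ u′ l′ → Arc l′ u′ v → u′ ≡ u)

module Expansions (B : List Bool) (canonical : Canonical B) where
  open Fence (bitAt B)

  L : ℕ
  L = length B

  N : ℕ
  N = bitsValue (false ∷ B)

  Valid : (ℕ → Bool) → Set
  Valid d = Monotone d × (∀ {i} → L ≤ i → d i ≡ false)

  shiftIn : (ℕ → Bool) → ℕ → Bool
  shiftIn d zero    = false
  shiftIn d (suc i) = d i

  valid⇒carries : ∀ {d} → Valid d → Carries (false ∷ B) (shiftIn d)
  valid⇒carries (mono , bounded) =
    (λ { zero → false≤ _ ; (suc i) → monotone⇒edgeMonotone mono i }) , λ { {suc i} (s≤s L≤i) → bounded L≤i }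

  carries⇒valid : ∀ {c} → Carries (false ∷ B) c → Valid (c ∘ suc)
  carries⇒valid (edge , bounded) = edgeMonotone⇒monotone (edge ∘ suc) , bounded ∘ s≤s

  word : (ℕ → Bool) → Word
  word d = reverse (digitsOf (false ∷ B) (shiftIn d))

  vertex : ∀ d → Valid d → H N
  vertex d v = word d
             , subst (λ A → A) (sym (leadingNonzero-reverse ds)) (digitsOf-lastNonzero false B (shiftIn d) canonical (valid⇒carries v))
             , trans (value-reverse ds) (digitsOf-value (false ∷ B) (shiftIn d) (valid⇒carries v))
    where ds = digitsOf (false ∷ B) (shiftIn d)

  -- Carry i of an expansion is its carry into position i + 1 of false ∷ B; the carry into
  -- position 0 always vanishes.
  carries : Word → ℕ → Bool
  carries w i = carriesOf (false ∷ B) false (reverse w) (suc i)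

  represents : (u : H N) → Represents (false ∷ B) false (reverse (proj₁ u))
  represents (w , _ , value≡N) = trans (sym (value-reverse (reverse w))) (trans (cong value (reverse-involutive w)) value≡N)

  carries-valid : (u : H N) → Valid (carries (proj₁ u))
  carries-valid u = carries⇒valid (carriesOf-carries (false ∷ B) false (reverse (proj₁ u)) (represents u))

  carries-vertex : ∀ d v → carries (proj₁ (vertex d v)) ≗ d
  carries-vertex d v i =
    trans (cong (λ ds → carriesOf (false ∷ B) false ds (suc i)) (reverse-involutive (digitsOf (false ∷ B) (shiftIn d))))
          (carriesOf-digitsOf (false ∷ B) (shiftIn d) (valid⇒carries v) (suc i))

  word-cong : ∀ {d d′} → d ≗ d′ → word d ≡ word d′
  word-cong d≗d′ = cong reverse (digitsOf-cong (false ∷ B) λ { zero → refl ; (suc i) → d≗d′ i })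

  word-carries : (u : H N) → word (carries (proj₁ u)) ≡ proj₁ u
  word-carries u@(w , leading , _) = begin
    word (carries w)
      ≡⟨ cong reverse (digitsOf-cong (false ∷ B) λ { zero → refl ; (suc _) → refl }) ⟩
    reverse (digitsOf (false ∷ B) (carriesOf (false ∷ B) false (reverse w)))
      ≡⟨ cong reverse (digitsOf-carriesOf false B false (reverse w) canonical (represents u) last) ⟩
    reverse (reverse w)
      ≡⟨ reverse-involutive w ⟩
    w ∎
    where
    open ≡-Reasoning
    last : Last Nonzero (reverse w)
    last = subst (λ A → A) (leadingNonzero-reverse (reverse w)) (subst LeadingNonzero (sym (reverse-involutive w)) leading)

  carries-injective : ∀ u w → carries (proj₁ u) ≗ carries (proj₁ w) → u ≡ w
  carries-injective u w same = H-≡ (trans (sym (word-carries u)) (trans (word-cong same) (word-carries w)))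

  vertex-unique : ∀ d v (u : H N) → carries (proj₁ u) ≗ d → u ≡ vertex d v
  vertex-unique d v u u≗d = carries-injective u (vertex d v) (λ i → trans (u≗d i) (sym (carries-vertex d v i)))

  arc⇒lowered : ∀ {l u w} → Arc l u w → ∃[ k ] LoweredAt k (carries (proj₁ u)) (carries (proj₁ w)) × bitAt B k ≡ l
  arc⇒lowered {u = u} {w} a =
    let k , lowered , label = edge⇒lowered (false ∷ B) false a (represents u) (represents w)
    in k , lowered-pred lowered , label

  lowered⇒arc : ∀ {d d′} (v : Valid d) (v′ : Valid d′) {k} → LoweredAt k d d′ → Arc (bitAt B k) (vertex d v) (vertex d′ v′)
  lowered⇒arc {d} {d′} v v′ {k} lowered =
    lowered⇒edge (false ∷ B) (shiftIn d) (shiftIn d′) k (valid⇒carries v) (valid⇒carries v′) (lowered-suc refl lowered)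

-- Vertices with a unique predecessor, and reachability

module CarryGraph (B : List Bool) (canonical : Canonical B) where
  open Fence (bitAt B)
  open Expansions B canonical

  private
    predecessor : ∀ {n} → 0 < n → ∃[ l ] suc l ≡ n
    predecessor {suc l} _ = l , refl

  up-stays-in-range : ∀ {i t} → i < L → i ≼ t → t < L
  up-stays-in-range i<L (inj₂ (t≤i , _)) = ≤-<-trans t≤i i<L
  up-stays-in-range {i} {t} i<L (inj₁ (i≤t , F)) with t <? L
  ... | yes t<L = t<L
  ... | no  t≮L =
    let l , 1+l≡L = predecessor (≤-<-trans z≤n i<L)
    in contradiction (trans (sym (F (≤-pred (subst (i <_) (sym 1+l≡L) i<L)) (subst (_≤ t) (sym 1+l≡L) (≮⇒≥ t≮L))))
                            (canonical-last B canonical 1+l≡L)) λ ()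

  down-stays-below : ∀ {t s} → t ≼ s → s ≤ L → t ≤ L
  down-stays-below (inj₁ (t≤s , _)) s≤L = ≤-trans t≤s s≤L
  down-stays-below {t} (inj₂ (s≤t , T)) s≤L with t ≤? L
  ... | yes t≤L = t≤L
  ... | no  t≰L = contradiction (trans (sym (T s≤L (≰⇒> t≰L))) (bitAt-beyond B ≤-refl)) λ ()

  principal : ℕ → ℕ → Bool
  principal k i = does ((i <? L) ×-dec ¬? (i ≼? k))

  principal≡true : ∀ {k i} → principal k i ≡ true → i < L × ¬ i ≼ k
  principal≡true {k} {i} = does-true ((i <? L) ×-dec ¬? (i ≼? k))

  principal≡true⁻¹ : ∀ {k i} → i < L → ¬ i ≼ k → principal k i ≡ true
  principal≡true⁻¹ {k} {i} i<L ¬i≼k = dec-true ((i <? L) ×-dec ¬? (i ≼? k)) (i<L , ¬i≼k)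

  principal≡false : ∀ {k i} → principal k i ≡ false → L ≤ i ⊎ i ≼ k
  principal≡false {k} {i} eq with i <? L | i ≼? k
  ... | no  i≮L | _       = inj₁ (≮⇒≥ i≮L)
  ... | yes _   | yes i≼k = inj₂ i≼k
  ... | yes i<L | no ¬i≼k = contradiction (i<L , ¬i≼k) (does-false ((i <? L) ×-dec ¬? (i ≼? k)) eq)

  principal≡false⁻¹ : ∀ {k i} → L ≤ i ⊎ i ≼ k → principal k i ≡ false
  principal≡false⁻¹ {k} {i} beyond-or-below =
    dec-false ((i <? L) ×-dec ¬? (i ≼? k))
              λ (i<L , ¬i≼k) → [ (λ L≤i → contradiction i<L (≤⇒≯ L≤i)) , ¬i≼k ]′ beyond-or-below

  principal-valid : ∀ k → Valid (principal k)
  principal-valid k = (λ {i} {j} i≼j → ≤ᵇ-from-true λ pki →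
                         let i<L , ¬i≼k = principal≡true pki
                         in principal≡true⁻¹ (up-stays-in-range i<L i≼j) (λ j≼k → ¬i≼k (≼-trans i≼j j≼k)))
                    , λ L≤i → principal≡false⁻¹ (inj₁ L≤i)

  principal-vertex : ℕ → H N
  principal-vertex k = vertex (principal k) (principal-valid k)

  carries-principal : ∀ k → carries (proj₁ (principal-vertex k)) ≗ principal k
  carries-principal k = carries-vertex (principal k) (principal-valid k)

  true⇒in-range : ∀ {d} → Valid d → ∀ {i} → d i ≡ true → i < L
  true⇒in-range (_ , bounded) {i} di with i <? L
  ... | yes i<L = i<L
  ... | no  i≮L = contradiction (trans (sym di) (bounded (≮⇒≥ i≮L))) λ ()

  raise-valid : ∀ {d m} → Valid d → m < L → Maximal (λ t → d t ≡ false) m → Valid (update m true d)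
  raise-valid {d} {m} (mono , bounded) m<L maximal =
    raise-monotone mono maximal , λ L≤i → trans (update-other true d (λ { refl → <⇒≱ m<L L≤i })) (bounded L≤i)

  lower-valid : ∀ {d m} → Valid d → Minimal (λ t → d t ≡ true) m → Valid (update m false d)
  lower-valid {d} {m} (mono , bounded) minimal = lower-monotone mono minimal , beyond
    where
    beyond : ∀ {i} → L ≤ i → update m false d i ≡ false
    beyond {i} L≤i with i ≟ m
    ... | yes refl = refl
    ... | no  _    = bounded L≤i

  predecessor-valid : ∀ {k} → k < L → Valid (update k true (principal k))
  predecessor-valid {k} k<L = raise-valid (principal-valid k) k<L maximal
    where
    maximal : Maximal (λ t → principal k t ≡ false) k
    maximal k≼t pkt with principal≡false pkt
    ... | inj₁ L≤t = contradiction (up-stays-in-range k<L k≼t) (≤⇒≯ L≤t)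
    ... | inj₂ t≼k = ≼-antisym t≼k k≼t

  principal-predecessor : ∀ {k} → k < L → H N
  principal-predecessor {k} k<L = vertex (update k true (principal k)) (predecessor-valid k<L)

  principal-arc : ∀ {k} (k<L : k < L) → Arc (bitAt B k) (principal-predecessor k<L) (principal-vertex k)
  principal-arc {k} k<L = lowered⇒arc (predecessor-valid k<L) (principal-valid k) (update-raised (principal≡false⁻¹ (inj₂ ≼-refl)))

  lowered-onto-principal : ∀ {k k′ d} → Valid d → LoweredAt k′ d (principal k) → k′ ≡ k
  lowered-onto-principal {k} {k′} {d} valid@(mono , _) (dk′ , pk′ , same) with k′ ≟ k
  ... | yes k′≡k = k′≡k
  ... | no  k′≢k = contradiction (trans (sym (≤ᵇ-true (mono k′≼k) dk′)) dk≡false) λ ()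
    where
    k′≼k : k′ ≼ k
    k′≼k = [ (λ L≤k′ → contradiction (true⇒in-range valid dk′) (≤⇒≯ L≤k′)) , (λ k′≼k → k′≼k) ]′ (principal≡false pk′)
    dk≡false : d k ≡ false
    dk≡false = trans (same (k′≢k ∘ sym)) (principal≡false⁻¹ (inj₂ ≼-refl))

  principal-arc-unique : ∀ {k l u} (k<L : k < L) → Arc l u (principal-vertex k) → u ≡ principal-predecessor k<L × l ≡ bitAt B k
  principal-arc-unique {k} {l} {u} k<L a with arc⇒lowered {u = u} {principal-vertex k} a
  ... | k′ , lowered , label with lowered-cong (λ _ → refl) (carries-principal k) lowered
  ...   | lowered′ with lowered-onto-principal (carries-valid u) lowered′
  ...     | refl = vertex-unique _ _ u (lowered⇒update lowered′) , sym label

  principal-uniquePredecessor : ∀ {k} → k < L → UniquePredecessor (principal-vertex k)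
  principal-uniquePredecessor k<L = principal-predecessor k<L , _ , principal-arc k<L , λ _ _ a → proj₁ (principal-arc-unique k<L a)

  raise-above : ∀ {d i} → Valid d → d i ≡ false → i < L →
                ∃[ m ] i ≼ m × d m ≡ false × m < L × Valid (update m true d)
  raise-above {d} v@(mono , _) di i<L =
    let m , i≼m , (dm , _) , maximal = maximal-above (bitAt B) {S} S? down (λ (_ , t≤L) → s≤s t≤L) (di , <⇒≤ i<L)
        m<L = up-stays-in-range i<L i≼m
    in m , i≼m , dm , m<L , raise-valid v m<L (λ m≼t dt → maximal m≼t (dt , <⇒≤ (up-stays-in-range m<L m≼t)))
    where
    S : ℕ → Set
    S t = d t ≡ false × t ≤ L
    S? : Decidable S
    S? t = (d t ≟ᵇ false) ×-dec (t ≤? L)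
    down : DownClosed S
    down t≼s (ds , s≤L) = ≤ᵇ-false (mono t≼s) ds , down-stays-below t≼s s≤L

  -- Every vanishing carry of v lies below a maximal one, and raising that gives an arc into
  -- v; uniqueness of the predecessor puts all of them below k.
  uniquePredecessor⇒principal : ∀ v → UniquePredecessor v → ∃[ k ] k < L × v ≡ principal-vertex k
  uniquePredecessor⇒principal v (u , _ , a , unique) with arc⇒lowered {u = u} {v} a
  ... | k , lowered@(uk , gk , _) , _ =
    k , true⇒in-range (carries-valid u) uk , vertex-unique (principal k) (principal-valid k) v g≗principal
    where
    g = carries (proj₁ v)
    valid = carries-valid v
    raised-predecessor : ∀ {m} → g m ≡ false → (valid′ : Valid (update m true g)) → carries (proj₁ u) m ≡ true
    raised-predecessor {m} gm valid′ =
      trans (cong (λ x → carries (proj₁ x) m) (sym (unique (vertex (update m true g) valid′) (bitAt B m) arc)))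
            (trans (carries-vertex _ valid′ m) (update-same m true g))
      where
      arc : Arc (bitAt B m) (vertex (update m true g) valid′) v
      arc = subst (Arc (bitAt B m) (vertex (update m true g) valid′)) (sym (vertex-unique g valid v (λ _ → refl)))
                  (lowered⇒arc valid′ valid (update-raised gm))
    below-k : ∀ {i} → g i ≡ false → i < L → i ≼ k
    below-k gi i<L with raise-above valid gi i<L
    ... | m , i≼m , gm , _ , valid′ with update-true {k} {g} {m} (trans (sym (lowered⇒update lowered m)) (raised-predecessor gm valid′))
    ...   | inj₁ m≡k     = subst (_ ≼_) m≡k i≼m
    ...   | inj₂ gm≡true = contradiction (trans (sym gm) gm≡true) λ ()
    g≗principal : g ≗ principal k
    g≗principal i with g i in gi
    ... | true  = sym (principal≡true⁻¹ (true⇒in-range valid gi)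
                        (λ i≼k → contradiction (trans (sym (≤ᵇ-true (proj₁ valid i≼k) gi)) gk) λ ()))
    ... | false with i <? L
    ...   | no  i≮L = sym (principal≡false⁻¹ (inj₁ (≮⇒≥ i≮L)))
    ...   | yes i<L = sym (principal≡false⁻¹ (inj₂ (below-k gi i<L)))

  reach⇒below : ∀ {u w} → Reach u w → ∀ i → carries (proj₁ w) i 𝔹.≤ carries (proj₁ u) i
  reach⇒below ε i = b≤b
  reach⇒below {u} (_◅_ {j = v} (_ , a) r) i =
    ≤ᵇ-trans (reach⇒below r i) (lowered-≤ (proj₁ (proj₂ (arc⇒lowered {u = u} {v} a))) i)

  reach⇒≼ : ∀ {i j} → i < L → Reach (principal-vertex i) (principal-vertex j) → i ≼ j
  reach⇒≼ {i} {j} i<L r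
    with principal≡false (≤ᵇ-false (subst₂ 𝔹._≤_ (carries-principal j i) (carries-principal i i) (reach⇒below r i))
                                   (principal≡false⁻¹ (inj₂ ≼-refl)))
  ... | inj₁ L≤i = contradiction i<L (≤⇒≯ L≤i)
  ... | inj₂ i≼j = i≼j

  walk : ∀ n {d d′} (v : Valid d) (v′ : Valid d′) → count d L ≡ n → (∀ i → d′ i 𝔹.≤ d i) →
         Reach (vertex d v) (vertex d′ v′)
  walk n {d} {d′} v@(mono , bounded) v′@(mono′ , bounded′) count≡n below
    with bounded-search (λ t → (d t ≟ᵇ true) ×-dec (d′ t ≟ᵇ false)) L
  ... | inj₂ none = subst (Reach (vertex d v)) (vertex-unique d′ v′ (vertex d v) (λ i → trans (carries-vertex d v i) (agree i))) ε
    where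
    agree : d ≗ d′
    agree i with i <? L
    ... | no  i≮L = trans (bounded (≮⇒≥ i≮L)) (sym (bounded′ (≮⇒≥ i≮L)))
    ... | yes i<L with d i | d′ i | below i | none i<L
    ...   | false | false | _ | _ = refl
    ...   | true  | true  | _ | _ = refl
    ...   | true  | false | _ | ¬both = contradiction (refl , refl) ¬both
  ... | inj₁ (t , _ , dt , d′t)
    with minimal-below {S = λ x → d x ≡ true} (λ x → d x ≟ᵇ true) (λ i≼k → ≤ᵇ-true (mono i≼k)) (true⇒in-range v) dt
  ...   | m , m≼t , dm , minimal with n | count-lowered L (update-lowered {m} {d} dm) (true⇒in-range v dm)
  ...     | zero   | count≡1+ = contradiction (trans (sym count≡n) count≡1+) λ ()
  ...     | suc n′ | count≡1+ =
    (bitAt B m , lowered⇒arc v v₁ (update-lowered dm)) ◅ walk n′ v₁ v′ (suc-injective (trans (sym count≡1+) count≡n)) below₁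
    where
    v₁ = lower-valid v minimal
    below₁ : ∀ i → d′ i 𝔹.≤ update m false d i
    below₁ i with i ≟ m
    ... | yes refl = ≤ᵇ-reflexive (≤ᵇ-false (mono′ m≼t) d′t)
    ... | no  _    = below i

  ≼⇒reach : ∀ {i j} → i ≼ j → Reach (principal-vertex i) (principal-vertex j)
  ≼⇒reach {i} {j} i≼j = walk _ (principal-valid i) (principal-valid j) refl below
    where
    below : ∀ t → principal j t 𝔹.≤ principal i t
    below t = ≤ᵇ-from-true λ pjt → let t<L , ¬t≼j = principal≡true pjt
                                   in principal≡true⁻¹ t<L (λ t≼i → ¬t≼j (≼-trans t≼i i≼j))

  principal-injective : ∀ {i j} → i < L → j < L → principal-vertex i ≡ principal-vertex j → i ≡ j
  principal-injective i<L j<L eq = ≼-antisym (reach⇒≼ i<L (subst (Reach _) eq ε)) (reach⇒≼ j<L (subst (Reach _) (sym eq) ε))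

-- Transport along an isomorphism

module _ {m n : ℕ} (iso : AIso m n) where
  open AIso iso

  to-arc : ∀ {l u w} → Arc l u w → Arc l (to u) (to w)
  to-arc {true}  {u} {w} = Equivalence.to (pres→ u w)
  to-arc {false} {u} {w} = Equivalence.to (pres↠ u w)

  to-reach : ∀ {u w} → Reach u w → Reach (to u) (to w)
  to-reach = gmap to (λ (l , a) → l , to-arc a)

AIso-sym : ∀ {m n} → AIso m n → AIso n m
AIso-sym {m} {n} iso = record
  { bij  = ↔-sym bij
  ; pres→ = reflect pres→
  ; pres↠ = reflect pres↠
  }
  where
  open AIso iso
  open Inverse bij using (from; strictlyInverseˡ)
  reflect : ∀ {R : Word → Word → Set} → ((u w : H m) → R (proj₁ u) (proj₁ w) ⇔ R (proj₁ (to u)) (proj₁ (to w))) →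
            (u w : H n) → R (proj₁ u) (proj₁ w) ⇔ R (proj₁ (from u)) (proj₁ (from w))
  reflect {R} pres u w = mk⇔
    (λ r → Equivalence.from (pres (from u) (from w)) (subst₂ R′ (sym (strictlyInverseˡ u)) (sym (strictlyInverseˡ w)) r))
    (λ r → subst₂ R′ (strictlyInverseˡ u) (strictlyInverseˡ w) (Equivalence.to (pres (from u) (from w)) r))
    where
    R′ : H n → H n → Set
    R′ x y = R (proj₁ x) (proj₁ y)

to-uniquePredecessor : ∀ {m n} (iso : AIso m n) {v} → UniquePredecessor v → UniquePredecessor (AIso.to iso v)
to-uniquePredecessor iso {v} (u , l , a , unique) = to u , l , to-arc iso a , λ u′ l′ a′ →
  trans (sym (strictlyInverseˡ u′))
        (cong to (unique (from u′) l′ (subst (Arc l′ (from u′)) (strictlyInverseʳ v) (to-arc (AIso-sym iso) a′))))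
  where open AIso iso using (bij; to)
        open Inverse bij using (from; strictlyInverseˡ; strictlyInverseʳ)

module _ (B B′ : List Bool) (canonical : Canonical B) (canonical′ : Canonical B′)
         (iso : AIso (bitsValue (false ∷ B)) (bitsValue (false ∷ B′))) where
  private
    module G  = CarryGraph B canonical
    module G′ = CarryGraph B′ canonical′
  open AIso iso using (to)

  principal-image : ∀ {k} → k < length B → ∃[ k′ ] k′ < length B′ × to (G.principal-vertex k) ≡ G′.principal-vertex k′
  principal-image k<L = G′.uniquePredecessor⇒principal _ (to-uniquePredecessor iso (G.principal-uniquePredecessor k<L))

  inducedMap : ℕ → ℕ
  inducedMap k with k <? length B
  ... | yes k<L = proj₁ (principal-image k<L)
  ... | no  _   = 0

  inducedMap-spec : ∀ {k} → k < length B → inducedMap k < length B′ × to (G.principal-vertex k) ≡ G′.principal-vertex (inducedMap k)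
  inducedMap-spec {k} k<L with k <? length B
  ... | yes k<L′ = proj₂ (principal-image k<L′)
  ... | no  k≮L  = contradiction k<L k≮L

  inducedMap-monotone : ∀ {i j} → i < length B → j < length B → i ≼⟨ B ⟩ j → inducedMap i ≼⟨ B′ ⟩ inducedMap j
  inducedMap-monotone i<L j<L i≼j =
    G′.reach⇒≼ (proj₁ (inducedMap-spec i<L))
               (subst₂ Reach (proj₂ (inducedMap-spec i<L)) (proj₂ (inducedMap-spec j<L)) (to-reach iso (G.≼⇒reach i≼j)))

  inducedMap-label : ∀ {k} → k < length B → bitAt B′ (inducedMap k) ≡ bitAt B k
  inducedMap-label {k} k<L =
    sym (proj₂ (G′.principal-arc-unique {l = bitAt B k} {u} (proj₁ (inducedMap-spec k<L))
                  (subst (Arc (bitAt B k) u) (proj₂ (inducedMap-spec k<L)) (to-arc iso (G.principal-arc k<L)))))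
    where u = to (G.principal-predecessor k<L)

inducedMap-inverse : ∀ B B′ (canonical : Canonical B) (canonical′ : Canonical B′)
                     (iso : AIso (bitsValue (false ∷ B)) (bitsValue (false ∷ B′)))
                     (iso′ : AIso (bitsValue (false ∷ B′)) (bitsValue (false ∷ B))) →
                     (∀ x → AIso.to iso′ (AIso.to iso x) ≡ x) →
                     ∀ {k} → k < length B → inducedMap B′ B canonical′ canonical iso′ (inducedMap B B′ canonical canonical′ iso k) ≡ k
inducedMap-inverse B B′ canonical canonical′ iso iso′ inverse {k} k<L =
  G.principal-injective (proj₁ spec′) k<L (begin
    G.principal-vertex k″                             ≡⟨ sym (proj₂ spec′) ⟩
    AIso.to iso′ (G′.principal-vertex k′)             ≡⟨ cong (AIso.to iso′) (sym (proj₂ spec)) ⟩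
    AIso.to iso′ (AIso.to iso (G.principal-vertex k)) ≡⟨ inverse (G.principal-vertex k) ⟩
    G.principal-vertex k                              ∎)
  where
  open ≡-Reasoning
  module G  = CarryGraph B canonical
  module G′ = CarryGraph B′ canonical′
  k′ = inducedMap B B′ canonical canonical′ iso k
  k″ = inducedMap B′ B canonical′ canonical iso′ k′
  spec : k′ < length B′ × AIso.to iso (G.principal-vertex k) ≡ G′.principal-vertex k′
  spec = inducedMap-spec B B′ canonical canonical′ iso k<L
  spec′ : k″ < length B × AIso.to iso′ (G′.principal-vertex k′) ≡ G.principal-vertex k″
  spec′ = inducedMap-spec B′ B canonical′ canonical iso′ (proj₁ spec)

AIso⇒fenceIsomorphism : ∀ B B′ → Canonical B → Canonical B′ →
                        AIso (bitsValue (false ∷ B)) (bitsValue (false ∷ B′)) → FenceIsomorphism B B′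
AIso⇒fenceIsomorphism B B′ canonical canonical′ iso = record
  { to            = inducedMap B B′ canonical canonical′ iso
  ; from          = inducedMap B′ B canonical′ canonical iso⁻¹
  ; to-range      = proj₁ ∘ inducedMap-spec B B′ canonical canonical′ iso
  ; from-range    = proj₁ ∘ inducedMap-spec B′ B canonical′ canonical iso⁻¹
  ; from-to       = inducedMap-inverse B B′ canonical canonical′ iso iso⁻¹ (Inverse.strictlyInverseʳ (AIso.bij iso))
  ; to-from       = inducedMap-inverse B′ B canonical′ canonical iso⁻¹ iso (Inverse.strictlyInverseˡ (AIso.bij iso))
  ; to-monotone   = inducedMap-monotone B B′ canonical canonical′ iso
  ; from-monotone = inducedMap-monotone B′ B canonical′ canonical iso⁻¹
  ; to-label      = inducedMap-label B B′ canonical canonical′ iso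
  }
  where iso⁻¹ = AIso-sym iso

even-bits : ∀ {m} a → m ≡ a * 2 → m ≡ bitsValue (false ∷ binary a)
even-bits {m} a m≡a*2 = begin
  m                           ≡⟨ m≡a*2 ⟩
  a * 2                       ≡⟨ *-comm a 2 ⟩
  2 * a                       ≡⟨ sym (double≡2* a) ⟩
  double a                    ≡⟨ cong double (sym (binary-value a)) ⟩
  bitsValue (false ∷ binary a) ∎
  where open ≡-Reasoning

mainTheorem4 : (m n : ℕ) → 2 ∣ m → 2 ∣ n → Isomorphic m n → m ≡ n
mainTheorem4 m n (divides a m≡a*2) (divides b n≡b*2) iso =
  trans (even-bits a m≡a*2) (trans (cong (λ B → bitsValue (false ∷ B)) binary-a≡binary-b) (sym (even-bits b n≡b*2)))
  where
  fence-iso : FenceIsomorphism (binary a) (binary b)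
  fence-iso = AIso⇒fenceIsomorphism (binary a) (binary b) (binary-canonical a) (binary-canonical b)
                                    (subst₂ AIso (even-bits a m≡a*2) (even-bits b n≡b*2) iso)
  binary-a≡binary-b : binary a ≡ binary b
  binary-a≡binary-b = fenceIsomorphism⇒≡ (binary-canonical a) (binary-canonical b) fence-iso
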